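{- Let $q$ be a prime power, $\nu\ge1$, and let $X_1$---$X_2$ and $Y_1$---$Y_2$ be edges of $Spi(2\nu,q)$. Then these two edges are in the same orbit of the edge set under the action of $Sp_{2\nu}(\mathbb{F}_q,K_{2\nu})$ if and only if one of the following holds: (1) $t(X_1)=t(Y_1)$, $t(X_2)=t(Y_2)$ and $t(X_1+X_2)=t(Y_1+Y_2)$; (2) $t(X_1)=t(Y_2)$, $t(X_2)=t(Y_1)$ and $t(X_1+X_2)=t(Y_1+Y_2)$.
   Context: $\mathbb{F}_q^{(2\nu)}$ is the space of row vectors of length $2\nu$ over $\mathbb{F}_q$ and $K_{2\nu}=\begin{pmatrix}0 & I^{(\nu)}\\ -I^{(\nu)} & 0\end{pmatrix}$. $Sp_{2\nu}(\mathbb{F}_q,K_{2\nu})$ is the group of matrices $T$ with $TK_{2\nu}{}^tT=K_{2\nu}$. A subspace $P$ of dimension $m$ is identified with any $m\times2\nu$ matrix whose rows form a basis of $P$; $P$ is of type $(m,s)$ if $PK_{2\nu}{}^tP$ has rank $2s$, and $t(P)=(m,s)$ denotes its type. The graph $Spi(2\nu,q)$ has as vertex set all subspaces of $\mathbb{F}_q^{(2\nu)}$ other than $0$ and $\mathbb{F}_q^{(2\nu)}$, with an (unordered) edge $A$---$B$ between $A,B$ (not necessarily distinct) iff $AK_{2\nu}{}^tB=0$. The group $Sp_{2\nu}(\mathbb{F}_q,K_{2\nu})$ acts on edges by $T:\{A,B\}\mapsto\{AT,BT\}$. -}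

module Defs where

open import Level using (0ℓ)
open import Data.Nat using (ℕ; zero; suc; _+_; _*_; _^_; _≤_; _<_)
open import Data.Nat.Primality using (Prime)
open import Data.Fin using (Fin; splitAt; _≟_)
open import Data.Sum using (_⊎_; inj₁; inj₂)
open import Data.Product using (Σ; ∃; ∃-syntax; _×_; _,_)
open import Data.Bool using (if_then_else_)
open import Relation.Nullary using (¬_; does)
open import Relation.Binary.PropositionalEquality using (_≡_)
open import Function.Bundles using (_↔_)
open import Algebra.Structures using (IsCommutativeRing)

IsPrimePower : ℕ → Set
IsPrimePower q = ∃[ p ] ∃[ k ] (Prime p × 1 ≤ k × q ≡ p ^ k)

record FiniteField (q : ℕ) : Set₁ where
  infixl 6 _+ᶠ_
  infixl 7 _*ᶠ_
  field
    Carrier : Set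
    _+ᶠ_ _*ᶠ_ : Carrier → Carrier → Carrier
    -ᶠ_ : Carrier → Carrier
    0ᶠ 1ᶠ : Carrier
    isCommutativeRing : IsCommutativeRing _≡_ _+ᶠ_ _*ᶠ_ -ᶠ_ 0ᶠ 1ᶠ
    0≢1 : ¬ (0ᶠ ≡ 1ᶠ)
    inverse : ∀ x → ¬ (x ≡ 0ᶠ) → ∃[ y ] (x *ᶠ y ≡ 1ᶠ)
    enumeration : Carrier ↔ Fin q

module Geometry {q : ℕ} (F : FiniteField q) (ν : ℕ) where
  open FiniteField F

  ∑ : ∀ {n} → (Fin n → Carrier) → Carrier
  ∑ {zero} f = 0ᶠ
  ∑ {suc n} f = f Fin.zero +ᶠ ∑ (λ i → f (Fin.suc i))

  Mat : ℕ → ℕ → Set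
  Mat m n = Fin m → Fin n → Carrier

  _·_ : ∀ {m n k} → Mat m n → Mat n k → Mat m k
  (A · B) i j = ∑ (λ l → A i l *ᶠ B l j)

  ᵗ : ∀ {m n} → Mat m n → Mat n m
  ᵗ A i j = A j i

  _≐_ : ∀ {m n} → Mat m n → Mat m n → Set
  A ≐ B = ∀ i j → A i j ≡ B i j

  zeroMat : ∀ {m n} → Mat m n
  zeroMat _ _ = 0ᶠ

  δ : ∀ {n} → Fin n → Fin n → Carrier
  δ a b = if does (a ≟ b) then 1ᶠ else 0ᶠ

  N : ℕ
  N = ν + ν

  -- K_{2ν} = [[0, I], [-I, 0]]
  K : Mat N N
  K i j with splitAt ν i | splitAt ν j
  ... | inj₁ a | inj₂ b = δ a b
  ... | inj₂ a | inj₁ b = -ᶠ δ a b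
  ... | inj₁ _ | inj₁ _ = 0ᶠ
  ... | inj₂ _ | inj₂ _ = 0ᶠ

  IsSymplectic : Mat N N → Set
  IsSymplectic T = ((T · K) · ᵗ T) ≐ K

  InRowSpace : ∀ {m n} → (Fin n → Carrier) → Mat m n → Set
  InRowSpace {m} v A = Σ (Fin m → Carrier) (λ c → ∀ j → v j ≡ ∑ (λ i → c i *ᶠ A i j))

  SameRowSpace : ∀ {m m' n} → Mat m n → Mat m' n → Set
  SameRowSpace {m} {m'} {n} A B =
    (∀ i → InRowSpace {m'} {n} (A i) B) × (∀ i → InRowSpace {m} {n} (B i) A)

  LinIndepRows : ∀ {m n} → Mat m n → Set
  LinIndepRows {m} {n} A =
    (c : Fin m → Carrier) → (∀ j → ∑ (λ i → c i *ᶠ A i j) ≡ 0ᶠ) → ∀ i → c i ≡ 0ᶠ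

  HasRank : ∀ {m n} → Mat m n → ℕ → Set
  HasRank {m} {n} A r = Σ (Mat r n) λ B → (LinIndepRows {r} {n} B × SameRowSpace B A)

  HasType : ∀ {m} → Mat m N → ℕ → ℕ → Set
  HasType P d s = HasRank P d × HasRank ((P · K) · ᵗ P) (2 * s)

  SameType : ∀ {m m'} → Mat m N → Mat m' N → Set
  SameType P Q = ∃[ d ] ∃[ s ] (HasType P d s × HasType Q d s)

  -- a vertex of Spi(2ν,q): a subspace other than 0 and F_q^(2ν),
  -- given by a matrix whose rows form a basis
  record Vertex : Set where
    constructor vertex
    field
      dim : ℕ
      mat : Mat dim N
      indep : LinIndepRows mat
      nonzero : 1 ≤ dim
      proper : dim < N

  open Vertex public

  _≈ᵥ_ : Vertex → Vertex → Set
  X ≈ᵥ Y = SameRowSpace (mat X) (mat Y)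

  actMat : (X : Vertex) → Mat N N → Mat (dim X) N
  actMat X T = mat X · T

  record Edge : Set where
    constructor edge
    field
      end₁ end₂ : Vertex
      orth : ((mat end₁ · K) · ᵗ (mat end₂)) ≐ zeroMat

  open Edge public

  -- stacked matrix spanning X₁ + X₂
  sumMat : (X Y : Vertex) → Mat (dim X + dim Y) N
  sumMat X Y i with splitAt (dim X) i
  ... | inj₁ a = mat X a
  ... | inj₂ b = mat Y b

  -- unordered-pair equality {X₁T, X₂T} = {Y₁, Y₂} as subspaces
  MapsTo : Mat N N → Edge → Edge → Set
  MapsTo T e f =
    (SameRowSpace (actMat (end₁ e) T) (mat (end₁ f)) × SameRowSpace (actMat (end₂ e) T) (mat (end₂ f)))
    ⊎ (SameRowSpace (actMat (end₁ e) T) (mat (end₂ f)) × SameRowSpace (actMat (end₂ e) T) (mat (end₁ f)))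

  SameOrbit : Edge → Edge → Set
  SameOrbit e f = Σ (Mat N N) λ T → (IsSymplectic T × MapsTo T e f)

  TypeCondition : Edge → Edge → Set
  TypeCondition e f =
    (SameType (mat X₁) (mat Y₁) × SameType (mat X₂) (mat Y₂) × SameType (sumMat X₁ X₂) (sumMat Y₁ Y₂))
    ⊎ (SameType (mat X₁) (mat Y₂) × SameType (mat X₂) (mat Y₁) × SameType (sumMat X₁ X₂) (sumMat Y₁ Y₂))
    where
      X₁ = end₁ e
      X₂ = end₂ e
      Y₁ = end₁ f
      Y₂ = end₂ f

-- A symplectic T preserves dimensions and the rank of the Gram matrix P K ᵗP, hence types;
-- this gives the forward direction.
--
-- Conversely, let X₁ ⊥ X₂. Then X₁ ∩ X₂ lies in both radicals. Pick a basis I of X₁ ∩ X₂,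
-- extend it by E₁ to a basis of Rad X₁ and by E₂ to one of Rad X₂, and pick maximal families of
-- hyperbolic pairs (u, w) in X₁ and in X₂. The pairs of X₁ and X₂ are orthogonal to each other,
-- and E₂, E₁, I span Rad(X₁ + X₂); this totally isotropic family is paired off and the result is
-- completed to a symplectic basis B of F^(2ν) (Witt's extension argument). In B the bases of X₁,
-- X₂ and X₁ + X₂ sit in rows whose positions depend only on s₁, s₂, dim I, dim E₁ and dim E₂,
-- and these five numbers are determined by the three types. So two edges with equal types have
-- adapted bases B, B' with the same positions, and B⁻¹ B' maps the first edge to the second.
--
-- Everything is constructive: since the field is finite, membership in a span and the existence
-- of vectors with decidable properties are decided by exhaustive search, and this is how bases,
-- radicals and maximal families of pairs are found.
module Submission where

open import Defs
open import Level using (0ℓ)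
open import Data.Nat as ℕ using (ℕ; _≤_; zero; suc; z≤n; s≤s)
import Data.Nat.Properties as ℕP
open import Data.Fin as Fin using (Fin; splitAt; _↑ˡ_; _↑ʳ_; punchIn; toℕ; inject₁; fromℕ)
import Data.Fin.Properties as FinP
open import Data.Sum using (_⊎_; inj₁; inj₂)
open import Data.Product using (Σ; _×_; _,_; proj₁; proj₂)
open import Data.Empty using (⊥-elim)
open import Data.Unit using (⊤; tt)
open import Data.Vec.Functional using (_∷_; _++_; insertAt)
open import Data.Vec.Functional.Properties using (lookup-++ˡ; lookup-++ʳ; insertAt-lookup; insertAt-punchIn)
open import Relation.Nullary using (¬_; Dec; yes; no; ¬?)
open import Relation.Nullary.Decidable using (_×-dec_; decidable-stable)
open import Relation.Binary.PropositionalEquality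
open import Relation.Binary.Bundles using (Setoid)
import Relation.Binary.Reasoning.Setoid as SetoidReasoning
open import Function.Bundles using (_⇔_; Inverse; mk⇔)
open import Algebra.Bundles using (CommutativeRing)
import Algebra.Properties.Ring as RingProperties
import Algebra.Properties.CommutativeMonoid.Sum as MonoidSum
import Algebra.Properties.Semiring.Sum as SemiringSum
import Algebra.Solver.Ring.NaturalCoefficients.Default as RingSolver

module EdgeOrbits {q : ℕ} (F : FiniteField q) (ν : ℕ) where
  open FiniteField F
  open Geometry F ν

  ring : CommutativeRing 0ℓ 0ℓ
  ring = record { isCommutativeRing = isCommutativeRing }

  open CommutativeRing ring using
    (+-assoc; +-comm; *-assoc; *-comm; distribˡ; distribʳ; +-identityˡ; +-identityʳ;
     *-identityˡ; *-identityʳ; -‿inverseˡ; -‿inverseʳ; zeroˡ; zeroʳ; +-commutativeMonoid; semiring)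
  open RingProperties (CommutativeRing.ring ring) using
    (-0#≈0#; +-inverseʳ-unique; -‿involutive; -‿+-comm; -‿distribˡ-*; -‿distribʳ-*; x∙y⁻¹≈ε⇒x≈y)
  open MonoidSum +-commutativeMonoid using (sum; ∑-distrib-+; ∑-comm; sum-remove)
  open SemiringSum semiring using (*-distribˡ-sum)
  open RingSolver (CommutativeRing.commutativeSemiring ring) using (solve; _:+_; _:*_; _:=_)

  module Enum = Inverse enumeration

  _≟ᶠ_ : (x y : Carrier) → Dec (x ≡ y)
  x ≟ᶠ y with Enum.to x Fin.≟ Enum.to y
  ... | yes p = yes (trans (sym (Enum.strictlyInverseʳ x)) (trans (cong Enum.from p) (Enum.strictlyInverseʳ y)))
  ... | no np = no (λ e → np (cong Enum.to e))

  neg-*ˡ : ∀ x y → (-ᶠ x) *ᶠ y ≡ -ᶠ (x *ᶠ y)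
  neg-*ˡ x y = sym (-‿distribˡ-* x y)

  neg-*ʳ : ∀ x y → x *ᶠ (-ᶠ y) ≡ -ᶠ (x *ᶠ y)
  neg-*ʳ x y = sym (-‿distribʳ-* x y)

  +-identityʳ-≡ : ∀ x y → y ≡ 0ᶠ → x +ᶠ y ≡ x
  +-identityʳ-≡ x y e = trans (cong (x +ᶠ_) e) (+-identityʳ x)

  zeroʳ-≡ : ∀ x y → y ≡ 0ᶠ → x *ᶠ y ≡ 0ᶠ
  zeroʳ-≡ x y e = trans (cong (x *ᶠ_) e) (zeroʳ x)

  zeroˡ-≡ : ∀ x y → x ≡ 0ᶠ → x *ᶠ y ≡ 0ᶠ
  zeroˡ-≡ x y e = trans (cong (_*ᶠ y) e) (zeroˡ y)

  inv : (x : Carrier) → ¬ (x ≡ 0ᶠ) → Carrier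
  inv x nx = proj₁ (inverse x nx)

  inv-r : (x : Carrier) (nx : ¬ (x ≡ 0ᶠ)) → x *ᶠ inv x nx ≡ 1ᶠ
  inv-r x nx = proj₂ (inverse x nx)

  x*y≡0⇒y≡0 : ∀ x y → x *ᶠ y ≡ 0ᶠ → ¬ (x ≡ 0ᶠ) → y ≡ 0ᶠ
  x*y≡0⇒y≡0 x y e nx = begin
    y                        ≡⟨ sym (*-identityˡ y) ⟩
    1ᶠ *ᶠ y                  ≡⟨ cong (_*ᶠ y) (sym (trans (*-comm _ _) (inv-r x nx))) ⟩
    (inv x nx *ᶠ x) *ᶠ y     ≡⟨ *-assoc _ _ _ ⟩
    inv x nx *ᶠ (x *ᶠ y)     ≡⟨ zeroʳ-≡ _ _ e ⟩
    0ᶠ                       ∎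
    where open ≡-Reasoning

  c*v+s≡0⇒v≡-c⁻¹*s : ∀ c (nz : ¬ (c ≡ 0ᶠ)) v s → c *ᶠ v +ᶠ s ≡ 0ᶠ → v ≡ (-ᶠ inv c nz) *ᶠ s
  c*v+s≡0⇒v≡-c⁻¹*s c nz v s e = begin
    v                                   ≡⟨ sym (*-identityˡ v) ⟩
    1ᶠ *ᶠ v                             ≡⟨ cong (_*ᶠ v) (sym (trans (*-comm _ _) (inv-r c nz))) ⟩
    (inv c nz *ᶠ c) *ᶠ v                ≡⟨ *-assoc _ _ _ ⟩
    inv c nz *ᶠ (c *ᶠ v)                ≡⟨ cong (inv c nz *ᶠ_) (sym (-‿involutive _)) ⟩
    inv c nz *ᶠ (-ᶠ (-ᶠ (c *ᶠ v)))      ≡⟨ cong (λ t → inv c nz *ᶠ (-ᶠ t)) (sym (+-inverseʳ-unique _ _ e)) ⟩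
    inv c nz *ᶠ (-ᶠ s)                  ≡⟨ neg-*ʳ _ _ ⟩
    -ᶠ (inv c nz *ᶠ s)                  ≡⟨ -‿distribˡ-* _ _ ⟩
    (-ᶠ inv c nz) *ᶠ s                  ∎
    where open ≡-Reasoning

  ∑≡sum : ∀ {n} (f : Fin n → Carrier) → ∑ f ≡ sum f
  ∑≡sum {zero} f = refl
  ∑≡sum {suc n} f = cong (f Fin.zero +ᶠ_) (∑≡sum (λ i → f (Fin.suc i)))

  ∑-cong : ∀ {n} {f g : Fin n → Carrier} → (∀ i → f i ≡ g i) → ∑ f ≡ ∑ g
  ∑-cong {zero} e = refl
  ∑-cong {suc n} e = cong₂ _+ᶠ_ (e Fin.zero) (∑-cong (λ i → e (Fin.suc i)))

  ∑-zero : ∀ {n} {f : Fin n → Carrier} → (∀ i → f i ≡ 0ᶠ) → ∑ f ≡ 0ᶠ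
  ∑-zero {zero} e = refl
  ∑-zero {suc n} e = trans (cong₂ _+ᶠ_ (e Fin.zero) (∑-zero (λ i → e (Fin.suc i)))) (+-identityˡ 0ᶠ)

  ∑-+ : ∀ {n} (f g : Fin n → Carrier) → ∑ (λ i → f i +ᶠ g i) ≡ ∑ f +ᶠ ∑ g
  ∑-+ f g = begin
    ∑ (λ i → f i +ᶠ g i)   ≡⟨ ∑≡sum (λ i → f i +ᶠ g i) ⟩
    sum (λ i → f i +ᶠ g i) ≡⟨ ∑-distrib-+ f g ⟩
    sum f +ᶠ sum g         ≡⟨ sym (cong₂ _+ᶠ_ (∑≡sum f) (∑≡sum g)) ⟩
    ∑ f +ᶠ ∑ g             ∎
    where open ≡-Reasoning

  ∑-*ˡ : ∀ {n} (c : Carrier) (f : Fin n → Carrier) → ∑ (λ i → c *ᶠ f i) ≡ c *ᶠ ∑ f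
  ∑-*ˡ c f = begin
    ∑ (λ i → c *ᶠ f i)     ≡⟨ ∑≡sum (λ i → c *ᶠ f i) ⟩
    sum (λ i → c *ᶠ f i)   ≡⟨ sym (*-distribˡ-sum c f) ⟩
    c *ᶠ sum f             ≡⟨ cong (c *ᶠ_) (sym (∑≡sum f)) ⟩
    c *ᶠ ∑ f               ∎
    where open ≡-Reasoning

  ∑-*ʳ : ∀ {n} (c : Carrier) (f : Fin n → Carrier) → ∑ (λ i → f i *ᶠ c) ≡ ∑ f *ᶠ c
  ∑-*ʳ c f = trans (∑-cong (λ i → *-comm (f i) c)) (trans (∑-*ˡ c f) (*-comm c _))

  ∑-neg : ∀ {n} (f : Fin n → Carrier) → ∑ (λ i → -ᶠ f i) ≡ -ᶠ ∑ f
  ∑-neg {zero} f = sym -0#≈0#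
  ∑-neg {suc n} f = trans (cong (-ᶠ f Fin.zero +ᶠ_) (∑-neg (λ i → f (Fin.suc i)))) (-‿+-comm _ _)

  ∑-swap : ∀ {m n} (f : Fin m → Fin n → Carrier) → ∑ (λ i → ∑ (λ j → f i j)) ≡ ∑ (λ j → ∑ (λ i → f i j))
  ∑-swap f = begin
    ∑ (λ i → ∑ (λ j → f i j))     ≡⟨ trans (∑-cong (λ i → ∑≡sum (f i))) (∑≡sum (λ i → sum (f i))) ⟩
    sum (λ i → sum (λ j → f i j)) ≡⟨ ∑-comm f ⟩
    sum (λ j → sum (λ i → f i j)) ≡⟨ sym (trans (∑-cong (λ j → ∑≡sum (λ i → f i j))) (∑≡sum (λ j → sum (λ i → f i j)))) ⟩
    ∑ (λ j → ∑ (λ i → f i j))     ∎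
    where open ≡-Reasoning

  ∑-punchIn : ∀ {k} (i : Fin (suc k)) (f : Fin (suc k) → Carrier) → ∑ f ≡ f i +ᶠ ∑ (λ j → f (punchIn i j))
  ∑-punchIn i f = begin
    ∑ f                                ≡⟨ ∑≡sum f ⟩
    sum f                              ≡⟨ sum-remove {i = i} f ⟩
    f i +ᶠ sum (λ j → f (punchIn i j)) ≡⟨ cong (f i +ᶠ_) (sym (∑≡sum (λ j → f (punchIn i j)))) ⟩
    f i +ᶠ ∑ (λ j → f (punchIn i j))   ∎
    where open ≡-Reasoning

  ∑-single : ∀ {n} (f : Fin n → Carrier) (k : Fin n) → (∀ i → ¬ (i ≡ k) → f i ≡ 0ᶠ) → ∑ f ≡ f k
  ∑-single {suc n} f Fin.zero h = +-identityʳ-≡ _ _ (∑-zero (λ i → h (Fin.suc i) (λ ())))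
  ∑-single {suc n} f (Fin.suc k) h = trans (cong (_+ᶠ ∑ (λ i → f (Fin.suc i))) (h Fin.zero (λ ())))
    (trans (+-identityˡ _) (∑-single (λ i → f (Fin.suc i)) k (λ i ne → h (Fin.suc i) (λ e → ne (FinP.suc-injective e)))))

  ∑-++ : ∀ {m n} (f : Fin (m ℕ.+ n) → Carrier) → ∑ f ≡ ∑ (λ i → f (i ↑ˡ n)) +ᶠ ∑ (λ j → f (m ↑ʳ j))
  ∑-++ {zero} {n} f = sym (+-identityˡ _)
  ∑-++ {suc m} {n} f = trans (cong (f Fin.zero +ᶠ_) (∑-++ {m} {n} (λ i → f (Fin.suc i)))) (sym (+-assoc _ _ _))

  δ-refl : ∀ {n} (i : Fin n) → δ i i ≡ 1ᶠ
  δ-refl i with i Fin.≟ i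
  ... | yes _ = refl
  ... | no ne = ⊥-elim (ne refl)

  δ-≢ : ∀ {n} (i j : Fin n) → ¬ (i ≡ j) → δ i j ≡ 0ᶠ
  δ-≢ i j ne with i Fin.≟ j
  ... | yes e = ⊥-elim (ne e)
  ... | no _ = refl

  δ-sym : ∀ {n} (i j : Fin n) → δ i j ≡ δ j i
  δ-sym i j with i Fin.≟ j | j Fin.≟ i
  ... | yes _ | yes _ = refl
  ... | no _ | no _ = refl
  ... | yes e | no ne = ⊥-elim (ne (sym e))
  ... | no ne | yes e = ⊥-elim (ne (sym e))

  ∑-δʳ : ∀ {n} (f : Fin n → Carrier) (k : Fin n) → ∑ (λ i → f i *ᶠ δ i k) ≡ f k
  ∑-δʳ f k = trans (∑-single _ k (λ i ne → zeroʳ-≡ _ _ (δ-≢ i k ne))) (trans (cong (f k *ᶠ_) (δ-refl k)) (*-identityʳ _))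

  ∑-δˡ : ∀ {n} (f : Fin n → Carrier) (k : Fin n) → ∑ (λ i → δ k i *ᶠ f i) ≡ f k
  ∑-δˡ f k = trans (∑-cong (λ i → trans (*-comm _ _) (cong (f i *ᶠ_) (δ-sym k i)))) (∑-δʳ f k)

  δ-injective : ∀ {m n} (g : Fin m → Fin n) → (∀ {a b} → g a ≡ g b → a ≡ b) → ∀ a b → δ (g a) (g b) ≡ δ a b
  δ-injective g gi a b with g a Fin.≟ g b | a Fin.≟ b
  ... | yes _ | yes _ = refl
  ... | no _ | no _ = refl
  ... | yes e | no ne = ⊥-elim (ne (gi e))
  ... | no ne | yes e = ⊥-elim (ne (cong g e))

  δ-inj-last : ∀ {p} (a : Fin p) → δ (inject₁ a) (fromℕ p) ≡ 0ᶠ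
  δ-inj-last {p} a = δ-≢ (inject₁ a) (fromℕ p) (λ e → FinP.fromℕ≢inject₁ (sym e))

  δ-last-inj : ∀ {p} (a : Fin p) → δ (fromℕ p) (inject₁ a) ≡ 0ᶠ
  δ-last-inj {p} a = δ-≢ (fromℕ p) (inject₁ a) FinP.fromℕ≢inject₁

  ↑ˡ≢↑ʳ : ∀ {m n} (a : Fin m) (b : Fin n) → ¬ (a ↑ˡ n ≡ m ↑ʳ b)
  ↑ˡ≢↑ʳ {m} {n} a b e with trans (sym (FinP.splitAt-↑ˡ m a n)) (trans (cong (splitAt m) e) (FinP.splitAt-↑ʳ m n b))
  ... | ()

  δ-lr : ∀ {m n} (a : Fin m) (b : Fin n) → δ (a ↑ˡ n) (m ↑ʳ b) ≡ 0ᶠ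
  δ-lr a b = δ-≢ _ _ (↑ˡ≢↑ʳ a b)

  δ-rl : ∀ {m n} (a : Fin m) (b : Fin n) → δ (m ↑ʳ b) (a ↑ˡ n) ≡ 0ᶠ
  δ-rl a b = δ-≢ _ _ (λ e → ↑ˡ≢↑ʳ a b (sym e))

  V : ℕ → Set
  V n = Fin n → Carrier

  Iᵐ : ∀ {n} → Mat n n
  Iᵐ = δ

  ·-assoc : ∀ {m n k l} (A : Mat m n) (B : Mat n k) (C : Mat k l) → ∀ i j → ((A · B) · C) i j ≡ (A · (B · C)) i j
  ·-assoc {m} {n} {k} A B C i j = begin
    ∑ (λ x → ∑ (λ y → A i y *ᶠ B y x) *ᶠ C x j)
      ≡⟨ ∑-cong {k} (λ x → trans (sym (∑-*ʳ (C x j) (λ y → A i y *ᶠ B y x))) (∑-cong {n} (λ y → *-assoc _ _ _))) ⟩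
    ∑ (λ x → ∑ (λ y → A i y *ᶠ (B y x *ᶠ C x j))) ≡⟨ ∑-swap (λ x y → A i y *ᶠ (B y x *ᶠ C x j)) ⟩
    ∑ (λ y → ∑ (λ x → A i y *ᶠ (B y x *ᶠ C x j))) ≡⟨ ∑-cong {n} (λ y → ∑-*ˡ (A i y) (λ x → B y x *ᶠ C x j)) ⟩
    ∑ (λ y → A i y *ᶠ ∑ (λ x → B y x *ᶠ C x j))   ∎
    where open ≡-Reasoning

  ·-congˡ : ∀ {m n k} {A A' : Mat m n} (B : Mat n k) → A ≐ A' → (A · B) ≐ (A' · B)
  ·-congˡ B e i j = ∑-cong (λ l → cong (_*ᶠ B l j) (e i l))

  ·-congʳ : ∀ {m n k} (A : Mat m n) {B B' : Mat n k} → B ≐ B' → (A · B) ≐ (A · B')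
  ·-congʳ A e i j = ∑-cong (λ l → cong (A i l *ᶠ_) (e l j))

  ᵗ-· : ∀ {m n k} (A : Mat m n) (B : Mat n k) → ᵗ (A · B) ≐ (ᵗ B · ᵗ A)
  ᵗ-· {n = n} A B i j = ∑-cong {n} (λ l → *-comm _ _)

  I-· : ∀ {m n} (A : Mat m n) → (Iᵐ · A) ≐ A
  I-· A i j = ∑-δˡ (λ l → A l j) i

  ·-I : ∀ {m n} (A : Mat m n) → (A · Iᵐ) ≐ A
  ·-I A i j = ∑-δʳ (A i) j

  ≐-trans : ∀ {m n} {A B C : Mat m n} → A ≐ B → B ≐ C → A ≐ C
  ≐-trans e f i j = trans (e i j) (f i j)

  ≐-sym : ∀ {m n} {A B : Mat m n} → A ≐ B → B ≐ A
  ≐-sym e i j = sym (e i j)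

  ≐-setoid : ℕ → ℕ → Setoid 0ℓ 0ℓ
  ≐-setoid m n = record
    { Carrier = Mat m n ; _≈_ = _≐_ ; isEquivalence = record { refl = λ i j → refl ; sym = ≐-sym ; trans = ≐-trans } }

  module ≐-Reasoning {m n : ℕ} = SetoidReasoning (≐-setoid m n)

  lc : ∀ {m n} → (Fin m → Carrier) → Mat m n → V n
  lc c A j = ∑ (λ i → c i *ᶠ A i j)

  span-row : ∀ {m n} (A : Mat m n) i → InRowSpace (A i) A
  span-row A i = δ i , λ j → sym (∑-δˡ (λ l → A l j) i)

  span-zero : ∀ {m n} (A : Mat m n) → InRowSpace (λ _ → 0ᶠ) A
  span-zero {m} A = (λ _ → 0ᶠ) , λ j → sym (∑-zero {m} (λ i → zeroˡ _))

  span-ext : ∀ {m n} {v w : V n} (A : Mat m n) → (∀ j → v j ≡ w j) → InRowSpace v A → InRowSpace w A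
  span-ext A e (c , p) = c , λ j → trans (sym (e j)) (p j)

  span-+ : ∀ {m n} {v w : V n} (A : Mat m n) → InRowSpace v A → InRowSpace w A → InRowSpace (λ j → v j +ᶠ w j) A
  span-+ {m} A (c , p) (d , r) = (λ i → c i +ᶠ d i) , λ j → trans (cong₂ _+ᶠ_ (p j) (r j))
    (trans (sym (∑-+ (λ i → c i *ᶠ A i j) (λ i → d i *ᶠ A i j))) (∑-cong {m} (λ i → sym (distribʳ _ _ _))))

  span-* : ∀ {m n} {v : V n} (a : Carrier) (A : Mat m n) → InRowSpace v A → InRowSpace (λ j → a *ᶠ v j) A
  span-* {m} a A (c , p) = (λ i → a *ᶠ c i) , λ j → trans (cong (a *ᶠ_) (p j))
    (trans (sym (∑-*ˡ a (λ i → c i *ᶠ A i j))) (∑-cong {m} (λ i → sym (*-assoc _ _ _))))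

  span-neg : ∀ {m n} {v : V n} (A : Mat m n) → InRowSpace v A → InRowSpace (λ j → -ᶠ v j) A
  span-neg {m} A (c , p) = (λ i → -ᶠ c i) , λ j → trans (cong -ᶠ_ (p j))
    (trans (sym (∑-neg (λ i → c i *ᶠ A i j))) (∑-cong {m} (λ i → sym (neg-*ˡ _ _))))

  lc-neg : ∀ {k} (d : Fin k → Carrier) (A : Mat k N) j → lc (λ i → -ᶠ d i) A j ≡ -ᶠ lc d A j
  lc-neg {k} d A j = trans (∑-cong {k} (λ i → neg-*ˡ _ _)) (∑-neg (λ i → d i *ᶠ A i j))

  span-lc : ∀ {m k n} (c : Fin k → Carrier) (A : Mat k n) (B : Mat m n) → (∀ i → InRowSpace (A i) B) → InRowSpace (lc c A) B
  span-lc {m} {k} c A B h = (λ l → ∑ (λ i → c i *ᶠ d i l)) , λ j → begin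
    ∑ (λ i → c i *ᶠ A i j)                         ≡⟨ ∑-cong {k} (λ i → cong (c i *ᶠ_) (proj₂ (h i) j)) ⟩
    ∑ (λ i → c i *ᶠ ∑ (λ l → d i l *ᶠ B l j))
      ≡⟨ ∑-cong {k} (λ i → trans (sym (∑-*ˡ (c i) (λ l → d i l *ᶠ B l j))) (∑-cong {m} (λ l → sym (*-assoc _ _ _)))) ⟩
    ∑ (λ i → ∑ (λ l → (c i *ᶠ d i l) *ᶠ B l j))    ≡⟨ ∑-swap (λ i l → (c i *ᶠ d i l) *ᶠ B l j) ⟩
    ∑ (λ l → ∑ (λ i → (c i *ᶠ d i l) *ᶠ B l j))    ≡⟨ ∑-cong {m} (λ l → ∑-*ʳ (B l j) (λ i → c i *ᶠ d i l)) ⟩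
    ∑ (λ l → ∑ (λ i → c i *ᶠ d i l) *ᶠ B l j)      ∎
    where
      open ≡-Reasoning
      d : Mat k m
      d i = proj₁ (h i)

  span-trans : ∀ {m k n} {v : V n} (A : Mat k n) (B : Mat m n) → InRowSpace v A → (∀ i → InRowSpace (A i) B) → InRowSpace v B
  span-trans A B (c , p) h = span-ext B (λ j → sym (p j)) (span-lc c A B h)

  SRS-refl : ∀ {m n} (A : Mat m n) → SameRowSpace A A
  SRS-refl A = span-row A , span-row A

  SRS-sym : ∀ {m k n} {A : Mat m n} {B : Mat k n} → SameRowSpace A B → SameRowSpace B A
  SRS-sym (p , r) = r , p

  SRS-trans : ∀ {m k l n} {A : Mat m n} {B : Mat k n} {C : Mat l n} → SameRowSpace A B → SameRowSpace B C → SameRowSpace A C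
  SRS-trans {A = A} {B} {C} (p , r) (p' , r') = (λ i → span-trans B C (p i) p') , (λ i → span-trans B A (r' i) r)

  SRS-ext : ∀ {m n} {A A' : Mat m n} → A ≐ A' → SameRowSpace A A'
  SRS-ext {A = A} {A'} e = (λ i → span-ext A' (λ j → sym (e i j)) (span-row A' i)) , (λ i → span-ext A (e i) (span-row A i))

  span-· : ∀ {m n k} {v : V n} (A : Mat m n) (T : Mat n k) → InRowSpace v A → InRowSpace (λ j → ∑ (λ l → v l *ᶠ T l j)) (A · T)
  span-· {m} {n} {v = v} A T (c , p) = c , λ j → begin
    ∑ (λ l → v l *ᶠ T l j)                       ≡⟨ ∑-cong {n} (λ l → trans (cong (_*ᶠ T l j) (p l)) (sym (∑-*ʳ (T l j) (λ i → c i *ᶠ A i l)))) ⟩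
    ∑ (λ l → ∑ (λ i → c i *ᶠ A i l *ᶠ T l j))    ≡⟨ ∑-swap (λ l i → c i *ᶠ A i l *ᶠ T l j) ⟩
    ∑ (λ i → ∑ (λ l → c i *ᶠ A i l *ᶠ T l j))    ≡⟨ ∑-cong {m} (λ i → trans (∑-cong {n} (λ l → *-assoc _ _ _)) (∑-*ˡ (c i) (λ l → A i l *ᶠ T l j))) ⟩
    ∑ (λ i → c i *ᶠ (A · T) i j)                 ∎
    where open ≡-Reasoning

  SRS-· : ∀ {m k n l} {A : Mat m n} {B : Mat k n} (T : Mat n l) → SameRowSpace A B → SameRowSpace (A · T) (B · T)
  SRS-· {A = A} {B} T (p , r) = (λ i → span-· B T (p i)) , (λ i → span-· A T (r i))

  indep-ext : ∀ {m n} {A A' : Mat m n} → A ≐ A' → LinIndepRows A → LinIndepRows A'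
  indep-ext {m} e ind c h = ind c (λ j → trans (∑-cong {m} (λ i → cong (c i *ᶠ_) (e i j))) (h j))

  indep-∷ : ∀ {m n} (v : V n) (A : Mat m n) → LinIndepRows A → ¬ InRowSpace v A → LinIndepRows (v ∷ A)
  indep-∷ {m} v A ind v∉A c h with c Fin.zero ≟ᶠ 0ᶠ
  ... | yes c₀≡0 = λ { Fin.zero → c₀≡0 ; (Fin.suc i) → ind (λ i → c (Fin.suc i)) tail-zero i }
    where
      tail-zero : ∀ j → ∑ (λ i → c (Fin.suc i) *ᶠ A i j) ≡ 0ᶠ
      tail-zero j = trans (sym (+-identityˡ _)) (trans (cong (_+ᶠ ∑ (λ i → c (Fin.suc i) *ᶠ A i j)) (sym (zeroˡ-≡ _ (v j) c₀≡0))) (h j))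
  ... | no c₀≢0 = ⊥-elim (v∉A ((λ i → (-ᶠ inv (c Fin.zero) c₀≢0) *ᶠ c (Fin.suc i)) , λ j →
         trans (c*v+s≡0⇒v≡-c⁻¹*s (c Fin.zero) c₀≢0 (v j) _ (h j))
           (trans (sym (∑-*ˡ _ (λ i → c (Fin.suc i) *ᶠ A i j))) (∑-cong {m} (λ i → sym (*-assoc _ _ _))))))

  -- Steinitz exchange: pivoting on a row Vs i₀ whose W-coordinate on W 0 is nonzero, the other
  -- rows of Vs can be corrected into an independent family in the span of tail W.
  module Exchange {n m k} (W : Mat (suc m) n) (Vs : Mat (suc k) n) (h : ∀ i → InRowSpace (Vs i) W)
                  (i₀ : Fin (suc k)) (a₀≢0 : ¬ (proj₁ (h i₀) Fin.zero ≡ 0ᶠ)) where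
    C : Mat (suc k) (suc m)
    C i = proj₁ (h i)

    a₀ = C i₀ Fin.zero
    p = punchIn i₀

    r : Fin k → Carrier
    r j = C (p j) Fin.zero *ᶠ inv a₀ a₀≢0

    r*a₀ : ∀ j → r j *ᶠ a₀ ≡ C (p j) Fin.zero
    r*a₀ j = trans (*-assoc _ _ _) (trans (cong (C (p j) Fin.zero *ᶠ_) (trans (*-comm _ _) (inv-r a₀ a₀≢0))) (*-identityʳ _))

    Vs′ : Mat k n
    Vs′ j l = Vs (p j) l +ᶠ -ᶠ (r j *ᶠ Vs i₀ l)

    S : Fin (suc k) → Fin n → Carrier
    S i l = ∑ (λ l′ → C i (Fin.suc l′) *ᶠ W (Fin.suc l′) l)

    cancel : ∀ x y z → (x +ᶠ y) +ᶠ -ᶠ (x +ᶠ z) ≡ y +ᶠ -ᶠ z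
    cancel x y z = begin
      (x +ᶠ y) +ᶠ -ᶠ (x +ᶠ z)    ≡⟨ cong ((x +ᶠ y) +ᶠ_) (sym (-‿+-comm x z)) ⟩
      (x +ᶠ y) +ᶠ (-ᶠ x +ᶠ -ᶠ z) ≡⟨ solve 4 (λ a b c d → ((a :+ b) :+ (c :+ d)) := ((a :+ c) :+ (b :+ d))) refl x y (-ᶠ x) (-ᶠ z) ⟩
      (x +ᶠ -ᶠ x) +ᶠ (y +ᶠ -ᶠ z) ≡⟨ cong (_+ᶠ (y +ᶠ -ᶠ z)) (-‿inverseʳ x) ⟩
      0ᶠ +ᶠ (y +ᶠ -ᶠ z)          ≡⟨ +-identityˡ _ ⟩
      y +ᶠ -ᶠ z                  ∎
      where open ≡-Reasoning

    Vs′-span : ∀ j → InRowSpace (Vs′ j) (λ l → W (Fin.suc l))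
    Vs′-span j = (λ l′ → C (p j) (Fin.suc l′) +ᶠ -ᶠ (r j *ᶠ C i₀ (Fin.suc l′))) , λ l → begin
      Vs (p j) l +ᶠ -ᶠ (r j *ᶠ Vs i₀ l)
        ≡⟨ cong₂ (λ x y → x +ᶠ -ᶠ (r j *ᶠ y)) (proj₂ (h (p j)) l) (proj₂ (h i₀) l) ⟩
      (C (p j) Fin.zero *ᶠ W Fin.zero l +ᶠ S (p j) l) +ᶠ -ᶠ (r j *ᶠ (a₀ *ᶠ W Fin.zero l +ᶠ S i₀ l))
        ≡⟨ cong (λ x → (C (p j) Fin.zero *ᶠ W Fin.zero l +ᶠ S (p j) l) +ᶠ -ᶠ x)
             (trans (distribˡ _ _ _) (cong (_+ᶠ r j *ᶠ S i₀ l) (trans (sym (*-assoc _ _ _)) (cong (_*ᶠ W Fin.zero l) (r*a₀ j))))) ⟩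
      (C (p j) Fin.zero *ᶠ W Fin.zero l +ᶠ S (p j) l) +ᶠ -ᶠ (C (p j) Fin.zero *ᶠ W Fin.zero l +ᶠ r j *ᶠ S i₀ l)
        ≡⟨ cancel _ _ _ ⟩
      S (p j) l +ᶠ -ᶠ (r j *ᶠ S i₀ l)
        ≡⟨ cong (S (p j) l +ᶠ_) (trans (cong -ᶠ_ (sym (∑-*ˡ (r j) (λ l′ → C i₀ (Fin.suc l′) *ᶠ W (Fin.suc l′) l))))
                                       (sym (∑-neg (λ l′ → r j *ᶠ (C i₀ (Fin.suc l′) *ᶠ W (Fin.suc l′) l))))) ⟩
      S (p j) l +ᶠ ∑ (λ l′ → -ᶠ (r j *ᶠ (C i₀ (Fin.suc l′) *ᶠ W (Fin.suc l′) l)))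
        ≡⟨ sym (∑-+ (λ l′ → C (p j) (Fin.suc l′) *ᶠ W (Fin.suc l′) l) (λ l′ → -ᶠ (r j *ᶠ (C i₀ (Fin.suc l′) *ᶠ W (Fin.suc l′) l)))) ⟩
      ∑ (λ l′ → C (p j) (Fin.suc l′) *ᶠ W (Fin.suc l′) l +ᶠ -ᶠ (r j *ᶠ (C i₀ (Fin.suc l′) *ᶠ W (Fin.suc l′) l)))
        ≡⟨ ∑-cong (λ l′ → trans (cong (C (p j) (Fin.suc l′) *ᶠ W (Fin.suc l′) l +ᶠ_)
                                      (trans (cong -ᶠ_ (sym (*-assoc _ _ _))) (sym (neg-*ˡ _ _)))) (sym (distribʳ _ _ _))) ⟩
      ∑ (λ l′ → (C (p j) (Fin.suc l′) +ᶠ -ᶠ (r j *ᶠ C i₀ (Fin.suc l′))) *ᶠ W (Fin.suc l′) l) ∎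
      where open ≡-Reasoning

    Vs′-indep : LinIndepRows Vs → LinIndepRows Vs′
    Vs′-indep ind d H j = trans (sym (insertAt-punchIn d i₀ x₀ j)) (ind cs cs-kills (p j))
      where
        x₀ = -ᶠ ∑ (λ j → d j *ᶠ r j)
        cs = insertAt d i₀ x₀
        cs-kills : ∀ l → ∑ (λ i → cs i *ᶠ Vs i l) ≡ 0ᶠ
        cs-kills l = begin
          ∑ (λ i → cs i *ᶠ Vs i l)
            ≡⟨ ∑-punchIn i₀ (λ i → cs i *ᶠ Vs i l) ⟩
          cs i₀ *ᶠ Vs i₀ l +ᶠ ∑ (λ j → cs (p j) *ᶠ Vs (p j) l)
            ≡⟨ cong₂ _+ᶠ_ (cong (_*ᶠ Vs i₀ l) (insertAt-lookup d i₀ x₀)) (∑-cong (λ j → cong (_*ᶠ Vs (p j) l) (insertAt-punchIn d i₀ x₀ j))) ⟩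
          x₀ *ᶠ Vs i₀ l +ᶠ ∑ (λ j → d j *ᶠ Vs (p j) l)
            ≡⟨ +-comm _ _ ⟩
          ∑ (λ j → d j *ᶠ Vs (p j) l) +ᶠ x₀ *ᶠ Vs i₀ l
            ≡⟨ cong (∑ (λ j → d j *ᶠ Vs (p j) l) +ᶠ_)
                 (trans (neg-*ˡ _ _) (trans (cong -ᶠ_ (sym (∑-*ʳ (Vs i₀ l) (λ j → d j *ᶠ r j)))) (sym (∑-neg (λ j → d j *ᶠ r j *ᶠ Vs i₀ l))))) ⟩
          ∑ (λ j → d j *ᶠ Vs (p j) l) +ᶠ ∑ (λ j → -ᶠ (d j *ᶠ r j *ᶠ Vs i₀ l))
            ≡⟨ sym (∑-+ (λ j → d j *ᶠ Vs (p j) l) (λ j → -ᶠ (d j *ᶠ r j *ᶠ Vs i₀ l))) ⟩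
          ∑ (λ j → d j *ᶠ Vs (p j) l +ᶠ -ᶠ (d j *ᶠ r j *ᶠ Vs i₀ l))
            ≡⟨ ∑-cong (λ j → trans (cong (d j *ᶠ Vs (p j) l +ᶠ_) (trans (cong -ᶠ_ (*-assoc _ _ _)) (sym (neg-*ʳ _ _)))) (sym (distribˡ _ _ _))) ⟩
          ∑ (λ j → d j *ᶠ Vs′ j l)
            ≡⟨ H l ⟩
          0ᶠ ∎
          where open ≡-Reasoning

  span-tail : ∀ {n m k} (W : Mat (suc m) n) (Vs : Mat k n) (h : ∀ i → InRowSpace (Vs i) W) →
    (∀ i → proj₁ (h i) Fin.zero ≡ 0ᶠ) → ∀ i → InRowSpace (Vs i) (λ l → W (Fin.suc l))
  span-tail W Vs h c₀≡0 i = (λ l → proj₁ (h i) (Fin.suc l)) , λ j →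
    trans (proj₂ (h i) j) (trans (cong (_+ᶠ ∑ (λ l → proj₁ (h i) (Fin.suc l) *ᶠ W (Fin.suc l) j)) (zeroˡ-≡ _ _ (c₀≡0 i))) (+-identityˡ _))

  steinitz : ∀ {n} m {k} (W : Mat m n) (Vs : Mat k n) → (∀ i → InRowSpace (Vs i) W) → LinIndepRows Vs → k ≤ m
  steinitz zero {zero} W Vs h ind = z≤n
  steinitz zero {suc k} W Vs h ind = ⊥-elim (0≢1 (sym (trans (sym (δ-refl {suc k} Fin.zero))
    (ind (δ Fin.zero) (λ j → trans (∑-δˡ (λ l → Vs l j) Fin.zero) (proj₂ (h Fin.zero) j)) Fin.zero))))
  steinitz (suc m) {zero} W Vs h ind = z≤n
  steinitz (suc m) {suc k} W Vs h ind with FinP.any? (λ i → ¬? (proj₁ (h i) Fin.zero ≟ᶠ 0ᶠ))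
  ... | no none = ℕP.m≤n⇒m≤1+n (steinitz m _ Vs (span-tail W Vs h c₀≡0) ind)
    where
      c₀≡0 : ∀ i → proj₁ (h i) Fin.zero ≡ 0ᶠ
      c₀≡0 i = decidable-stable (proj₁ (h i) Fin.zero ≟ᶠ 0ᶠ) (λ c₀≢0 → none (i , c₀≢0))
  ... | yes (i₀ , a₀≢0) = s≤s (steinitz m _ Vs′ Vs′-span (Vs′-indep ind))
    where open Exchange W Vs h i₀ a₀≢0

  indep-bound : ∀ {k n} (A : Mat k n) → LinIndepRows A → k ≤ n
  indep-bound {k} {n} A ind = steinitz n Iᵐ A (λ i → A i , λ j → sym (∑-δʳ (A i) j)) ind

  -- Exhaustive search over the finite field

  Respects≗ : ∀ {k} → ((Fin k → Carrier) → Set) → Set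
  Respects≗ P = ∀ c c′ → (∀ i → c i ≡ c′ i) → P c → P c′

  any-scalar? : (P : Carrier → Set) → (∀ x → Dec (P x)) → Dec (Σ Carrier P)
  any-scalar? P P? with FinP.any? (λ i → P? (Enum.from i))
  ... | yes (i , p) = yes (Enum.from i , p)
  ... | no np = no λ { (x , px) → np (Enum.to x , subst P (sym (Enum.strictlyInverseʳ x)) px) }

  any-vector? : ∀ k (P : (Fin k → Carrier) → Set) → Respects≗ P → (∀ c → Dec (P c)) → Dec (Σ (Fin k → Carrier) P)
  any-vector? zero P resp P? with P? (λ ())
  ... | yes p = yes (_ , p)
  ... | no np = no λ { (c , pc) → np (resp c _ (λ ()) pc) }
  any-vector? (suc k) P resp P?
    with any-scalar? (λ x → Σ (Fin k → Carrier) (λ c → P (x ∷ c)))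
           (λ x → any-vector? k (λ c → P (x ∷ c)) (λ c c′ e → resp _ _ (λ { Fin.zero → refl ; (Fin.suc i) → e i })) (λ c → P? (x ∷ c)))
  ... | yes (x , c , p) = yes (x ∷ c , p)
  ... | no np = no λ { (c , pc) → np (c Fin.zero , (λ i → c (Fin.suc i)) , resp c _ (λ { Fin.zero → refl ; (Fin.suc i) → refl }) pc) }

  span? : ∀ {m n} (v : V n) (A : Mat m n) → Dec (InRowSpace v A)
  span? {m} {n} v A = any-vector? m (λ c → ∀ j → v j ≡ ∑ (λ i → c i *ᶠ A i j))
    (λ c c′ e p j → trans (p j) (∑-cong {m} (λ i → cong (_*ᶠ A i j) (e i))))
    (λ c → FinP.all? (λ j → v j ≟ᶠ ∑ (λ i → c i *ᶠ A i j)))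

  lc-++ : ∀ {a b n} (c : Fin (a ℕ.+ b) → Carrier) (A : Mat a n) (B : Mat b n) j →
    lc c (A ++ B) j ≡ lc (λ i → c (i ↑ˡ b)) A j +ᶠ lc (λ i → c (a ↑ʳ i)) B j
  lc-++ {a} {b} c A B j = trans (∑-++ {a} {b} (λ i → c i *ᶠ (A ++ B) i j))
    (cong₂ _+ᶠ_ (∑-cong {a} (λ i → cong (c (i ↑ˡ b) *ᶠ_) (cong (λ r → r j) (lookup-++ˡ A B i))))
                (∑-cong {b} (λ i → cong (c (a ↑ʳ i) *ᶠ_) (cong (λ r → r j) (lookup-++ʳ A B i)))))

  lc-++-++ : ∀ {a b n} (c : Fin a → Carrier) (d : Fin b → Carrier) (A : Mat a n) (B : Mat b n) j →
    lc (c ++ d) (A ++ B) j ≡ lc c A j +ᶠ lc d B j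
  lc-++-++ {a} {b} c d A B j = trans (lc-++ (c ++ d) A B j)
    (cong₂ _+ᶠ_ (∑-cong {a} (λ i → cong (_*ᶠ A i j) (lookup-++ˡ c d i))) (∑-cong {b} (λ i → cong (_*ᶠ B i j) (lookup-++ʳ c d i))))

  span-++ : ∀ {a b n} {v w : V n} (A : Mat a n) (B : Mat b n) → InRowSpace v A → InRowSpace w B → InRowSpace (λ j → v j +ᶠ w j) (A ++ B)
  span-++ A B (c , p) (d , r) = (c ++ d) , λ j → trans (cong₂ _+ᶠ_ (p j) (r j)) (sym (lc-++-++ c d A B j))

  span-++ˡ : ∀ {a b n} {v : V n} (A : Mat a n) (B : Mat b n) → InRowSpace v A → InRowSpace v (A ++ B)
  span-++ˡ A B sp = span-ext (A ++ B) (λ j → +-identityʳ _) (span-++ A B sp (span-zero B))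

  span-++ʳ : ∀ {a b n} {v : V n} (A : Mat a n) (B : Mat b n) → InRowSpace v B → InRowSpace v (A ++ B)
  span-++ʳ A B sp = span-ext (A ++ B) (λ j → +-identityˡ _) (span-++ A B (span-zero A) sp)

  ∷-++ : ∀ {a b n} (v : V n) (E : Mat a n) (L : Mat b n) → (v ∷ (E ++ L)) ≐ ((v ∷ E) ++ L)
  ∷-++ v E L Fin.zero j = refl
  ∷-++ {a} v E L (Fin.suc i) j with splitAt a i
  ... | inj₁ x = refl
  ... | inj₂ y = refl

  record Extension {n} (S : V n → Set) {k} (L : Mat k n) : Set where
    field
      size : ℕ
      rows : Mat size n
      indep : LinIndepRows (rows ++ L)
      rows∈S : ∀ i → S (rows i)
      spans-S : ∀ v → S v → InRowSpace v (rows ++ L)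

  -- The fuel f is the codimension n ∸ (e + k) still available; it runs out only when rows ++ L
  -- already has n independent rows, which cannot be extended further.
  extend-fuel : ∀ {n} (S : V n → Set) (S? : ∀ v → Dec (S v)) → Respects≗ S → ∀ {k} (L : Mat k n) (f : ℕ) {e} (E : Mat e n) →
    (e ℕ.+ k) ℕ.+ f ≡ n → LinIndepRows (E ++ L) → (∀ i → S (E i)) → Extension S L
  extend-fuel {n} S S? resp L f {e} E eq ind E∈S
    with any-vector? n (λ v → S v × ¬ InRowSpace v (E ++ L))
           (λ c c′ h (sc , ns) → resp c c′ h sc , λ sp → ns (span-ext (E ++ L) (λ j → sym (h j)) sp))
           (λ v → S? v ×-dec ¬? (span? v (E ++ L)))
  ... | no none = record { size = e ; rows = E ; indep = ind ; rows∈S = E∈S ; spans-S = spans }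
    where
      spans : ∀ v → S v → InRowSpace v (E ++ L)
      spans v sv with span? v (E ++ L)
      ... | yes p = p
      ... | no v∉ = ⊥-elim (none (v , sv , v∉))
  ... | yes (v , sv , v∉) with f
  ...   | zero = ⊥-elim (ℕP.1+n≰n (subst (suc (e ℕ.+ _) ≤_) (sym (trans (sym (ℕP.+-identityʳ _)) eq))
                    (indep-bound ((v ∷ E) ++ L) (indep-ext (∷-++ v E L) (indep-∷ v (E ++ L) ind v∉)))))
  ...   | suc f′ = extend-fuel S S? resp L f′ (v ∷ E) (trans (sym (ℕP.+-suc _ f′)) eq)
                    (indep-ext (∷-++ v E L) (indep-∷ v (E ++ L) ind v∉))
                    (λ { Fin.zero → sv ; (Fin.suc i) → E∈S i })

  extend : ∀ {n} (S : V n → Set) (S? : ∀ v → Dec (S v)) → Respects≗ S → ∀ {k} (L : Mat k n) → LinIndepRows L → Extension S L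
  extend {n} S S? resp {k} L ind = extend-fuel S S? resp L (n ℕ.∸ k) {0} (λ ()) (ℕP.m+[n∸m]≡n (indep-bound L ind))
    (indep-ext (λ i j → refl) ind) (λ ())

  row : ∀ {n} → V n → Mat 1 n
  row v _ = v

  ++-elim : ∀ {a b} (P : Fin (a ℕ.+ b) → Set) → (∀ x → P (x ↑ˡ b)) → (∀ y → P (a ↑ʳ y)) → ∀ z → P z
  ++-elim {a} {b} P f g z with splitAt a z in eq
  ... | inj₁ x = subst P (FinP.splitAt⁻¹-↑ˡ eq) (f x)
  ... | inj₂ y = subst P (FinP.splitAt⁻¹-↑ʳ eq) (g y)

  ++-elim₂ : ∀ {a b} (P : Fin (a ℕ.+ b) → Fin (a ℕ.+ b) → Set) → (∀ x y → P (x ↑ˡ b) (y ↑ˡ b)) → (∀ x y → P (x ↑ˡ b) (a ↑ʳ y)) →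
    (∀ x y → P (a ↑ʳ x) (y ↑ˡ b)) → (∀ x y → P (a ↑ʳ x) (a ↑ʳ y)) → ∀ i j → P i j
  ++-elim₂ P f1 f2 f3 f4 = ++-elim (λ i → ∀ j → P i j) (λ x → ++-elim (P (x ↑ˡ _)) (f1 x) (f2 x)) (λ x → ++-elim (P (_ ↑ʳ x)) (f3 x) (f4 x))

  rank-unique : ∀ {m n r r'} (A : Mat m n) → HasRank A r → HasRank A r' → r ≡ r'
  rank-unique A (B , indB , sB) (B' , indB' , sB') =
    ℕP.≤-antisym (steinitz _ B' B (λ i → span-trans A B' (proj₁ sB i) (proj₁ (SRS-sym sB'))) indB)
                 (steinitz _ B B' (λ i → span-trans A B (proj₁ sB' i) (proj₁ (SRS-sym sB))) indB')

  coeffs : ∀ {m k n} {A : Mat m n} {B : Mat k n} → (∀ i → InRowSpace (A i) B) → Mat m k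
  coeffs h i = proj₁ (h i)

  coeffs-eq : ∀ {m k n} {A : Mat m n} {B : Mat k n} (h : ∀ i → InRowSpace (A i) B) → A ≐ (coeffs h · B)
  coeffs-eq h i j = proj₂ (h i) j

  zeroᵐ-· : ∀ {m n k} (A : Mat n k) → (zeroMat {m} {n} · A) ≐ zeroMat
  zeroᵐ-· {n = n} A i j = ∑-zero {n} (λ l → zeroˡ _)

  span-of-· : ∀ {m k n} {A : Mat m n} (C : Mat m k) (B : Mat k n) → A ≐ (C · B) → ∀ i → InRowSpace (A i) B
  span-of-· C B e i = C i , e i

  indep-row· : ∀ {m n} (A : Mat m n) → LinIndepRows A → (a : Fin m → Carrier) → (row a · A) ≐ zeroMat → ∀ i → a i ≡ 0ᶠ
  indep-row· A ind a h = ind a (λ j → h Fin.zero j)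

  indep-cancelʳ : ∀ {m d n} {M M′ : Mat m d} (B : Mat d n) → LinIndepRows B → (M · B) ≐ (M′ · B) → M ≐ M′
  indep-cancelʳ {M = M} {M′} B ind MB≐M′B i k = x∙y⁻¹≈ε⇒x≈y _ _ (ind (λ t → M i t +ᶠ -ᶠ M′ i t) kills k)
    where
      open ≡-Reasoning
      kills : ∀ j → ∑ (λ t → (M i t +ᶠ -ᶠ M′ i t) *ᶠ B t j) ≡ 0ᶠ
      kills j = begin
        ∑ (λ t → (M i t +ᶠ -ᶠ M′ i t) *ᶠ B t j)
          ≡⟨ ∑-cong (λ t → trans (distribʳ _ _ _) (cong (M i t *ᶠ B t j +ᶠ_) (neg-*ˡ _ _))) ⟩
        ∑ (λ t → M i t *ᶠ B t j +ᶠ -ᶠ (M′ i t *ᶠ B t j))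
          ≡⟨ ∑-+ (λ t → M i t *ᶠ B t j) (λ t → -ᶠ (M′ i t *ᶠ B t j)) ⟩
        (M · B) i j +ᶠ ∑ (λ t → -ᶠ (M′ i t *ᶠ B t j))
          ≡⟨ cong ((M · B) i j +ᶠ_) (∑-neg (λ t → M′ i t *ᶠ B t j)) ⟩
        (M · B) i j +ᶠ -ᶠ (M′ · B) i j
          ≡⟨ cong (λ x → (M · B) i j +ᶠ -ᶠ x) (sym (MB≐M′B i j)) ⟩
        (M · B) i j +ᶠ -ᶠ (M · B) i j
          ≡⟨ -‿inverseʳ _ ⟩
        0ᶠ ∎

  coeffs-leftInverse : ∀ {d m n} (B : Mat d n) (Y : Mat m n) (C : Mat m d) (D : Mat d m) → LinIndepRows B →
    Y ≐ (C · B) → B ≐ (D · Y) → (D · C) ≐ Iᵐ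
  coeffs-leftInverse B Y C D ind eY eB = indep-cancelʳ B ind (begin
    (D · C) · B    ≈⟨ ·-assoc D C B ⟩
    D · (C · B)    ≈⟨ ·-congʳ D eY ⟨
    D · Y          ≈⟨ eB ⟨
    B              ≈⟨ I-· B ⟨
    Iᵐ · B         ∎)
    where open ≐-Reasoning

  ᵗ-ext : ∀ {m n} {A A' : Mat m n} → A ≐ A' → ᵗ A ≐ ᵗ A'
  ᵗ-ext e i j = e j i

  ᵗI : ∀ {n} → ᵗ (Iᵐ {n}) ≐ Iᵐ
  ᵗI i j = δ-sym j i

  Iᵐ-indep : ∀ {n} → LinIndepRows (Iᵐ {n})
  Iᵐ-indep c h i = trans (sym (∑-δʳ c i)) (h i)

  indep-spans-all : ∀ {m n} (A : Mat m n) → LinIndepRows A → n ≤ m → ∀ v → InRowSpace v A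
  indep-spans-all A ind le v with span? v A
  ... | yes p = p
  ... | no np = ⊥-elim (ℕP.1+n≰n (ℕP.≤-trans (indep-bound (v ∷ A) (indep-∷ v A ind np)) le))

  indep-·-invertible : ∀ {d n k} (A : Mat d n) (T : Mat n k) (R : Mat k n) → (T · R) ≐ Iᵐ → LinIndepRows A → LinIndepRows (A · T)
  indep-·-invertible A T R TR ind a h = indep-row· A ind a (begin
    row a · A                ≈⟨ ·-I (row a · A) ⟨
    (row a · A) · Iᵐ         ≈⟨ ·-congʳ (row a · A) TR ⟨
    (row a · A) · (T · R)    ≈⟨ ·-assoc (row a · A) T R ⟨
    ((row a · A) · T) · R    ≈⟨ ·-congˡ R (·-assoc (row a) A T) ⟩
    (row a · (A · T)) · R    ≈⟨ ·-congˡ R (λ _ j → h j) ⟩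
    zeroMat · R              ≈⟨ zeroᵐ-· R ⟩
    zeroMat                  ∎)
    where open ≐-Reasoning

  invertible-of-basis : ∀ {k n} (B : Mat k n) → LinIndepRows B → (∀ v → InRowSpace v B) →
    Σ (Mat n k) λ R → ((B · R) ≐ Iᵐ) × ((R · B) ≐ Iᵐ)
  invertible-of-basis {k} {n} B indB sp = C , BC , CB
    where
      C : Mat n k
      C = coeffs (λ l → sp (Iᵐ l))
      CB : (C · B) ≐ Iᵐ
      CB l j = sym (proj₂ (sp (Iᵐ l)) j)
      k≤n : k ≤ n
      k≤n = indep-bound B indB
      indC : LinIndepRows C
      indC = indep-ext (I-· C) (indep-·-invertible Iᵐ C B CB Iᵐ-indep)
      spC : ∀ v → InRowSpace v C
      spC = indep-spans-all C indC k≤n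
      D : Mat k n
      D = coeffs (λ i → spC (Iᵐ i))
      DC : (D · C) ≐ Iᵐ
      DC i j = sym (proj₂ (spC (Iᵐ i)) j)
      DB : D ≐ B
      DB = begin
        D              ≈⟨ ·-I D ⟨
        D · Iᵐ         ≈⟨ ·-congʳ D CB ⟨
        D · (C · B)    ≈⟨ ·-assoc D C B ⟨
        (D · C) · B    ≈⟨ ·-congˡ B DC ⟩
        Iᵐ · B         ≈⟨ I-· B ⟩
        B              ∎
        where open ≐-Reasoning
      BC : (B · C) ≐ Iᵐ
      BC = ≐-trans (·-congˡ C (≐-sym DB)) DC

  -- The symplectic form

  form : V N → V N → Carrier
  form u v = ∑ (λ l → ∑ (λ m → u m *ᶠ K m l) *ᶠ v l)

  L↑ : Fin ν → Fin N
  L↑ a = a ↑ˡ ν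
  R↑ : Fin ν → Fin N
  R↑ a = ν ↑ʳ a

  K-ll : ∀ a b → K (L↑ a) (L↑ b) ≡ 0ᶠ
  K-ll a b rewrite FinP.splitAt-↑ˡ ν a ν | FinP.splitAt-↑ˡ ν b ν = refl
  K-lr : ∀ a b → K (L↑ a) (R↑ b) ≡ δ a b
  K-lr a b rewrite FinP.splitAt-↑ˡ ν a ν | FinP.splitAt-↑ʳ ν ν b = refl
  K-rl : ∀ a b → K (R↑ a) (L↑ b) ≡ -ᶠ δ a b
  K-rl a b rewrite FinP.splitAt-↑ʳ ν ν a | FinP.splitAt-↑ˡ ν b ν = refl
  K-rr : ∀ a b → K (R↑ a) (R↑ b) ≡ 0ᶠ
  K-rr a b rewrite FinP.splitAt-↑ʳ ν ν a | FinP.splitAt-↑ʳ ν ν b = refl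

  uK : V N → V N
  uK u l = ∑ (λ m → u m *ᶠ K m l)

  uK-l : ∀ u b → uK u (L↑ b) ≡ -ᶠ u (R↑ b)
  uK-l u b = begin
    ∑ (λ m → u m *ᶠ K m (L↑ b)) ≡⟨ ∑-++ {ν} {ν} (λ m → u m *ᶠ K m (L↑ b)) ⟩
    ∑ (λ a → u (L↑ a) *ᶠ K (L↑ a) (L↑ b)) +ᶠ ∑ (λ a → u (R↑ a) *ᶠ K (R↑ a) (L↑ b))
      ≡⟨ cong₂ _+ᶠ_ (∑-zero {ν} (λ a → zeroʳ-≡ _ _ (K-ll a b))) (∑-cong {ν} (λ a → trans (cong (u (R↑ a) *ᶠ_) (K-rl a b)) (neg-*ʳ _ _))) ⟩
    0ᶠ +ᶠ ∑ (λ a → -ᶠ (u (R↑ a) *ᶠ δ a b)) ≡⟨ +-identityˡ _ ⟩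
    ∑ (λ a → -ᶠ (u (R↑ a) *ᶠ δ a b)) ≡⟨ ∑-neg (λ a → u (R↑ a) *ᶠ δ a b) ⟩
    -ᶠ ∑ (λ a → u (R↑ a) *ᶠ δ a b) ≡⟨ cong -ᶠ_ (∑-δʳ (λ a → u (R↑ a)) b) ⟩
    -ᶠ u (R↑ b) ∎
    where open ≡-Reasoning

  uK-r : ∀ u b → uK u (R↑ b) ≡ u (L↑ b)
  uK-r u b = begin
    ∑ (λ m → u m *ᶠ K m (R↑ b)) ≡⟨ ∑-++ {ν} {ν} (λ m → u m *ᶠ K m (R↑ b)) ⟩
    ∑ (λ a → u (L↑ a) *ᶠ K (L↑ a) (R↑ b)) +ᶠ ∑ (λ a → u (R↑ a) *ᶠ K (R↑ a) (R↑ b))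
      ≡⟨ cong₂ _+ᶠ_ (∑-cong {ν} (λ a → cong (u (L↑ a) *ᶠ_) (K-lr a b))) (∑-zero {ν} (λ a → zeroʳ-≡ _ _ (K-rr a b))) ⟩
    ∑ (λ a → u (L↑ a) *ᶠ δ a b) +ᶠ 0ᶠ ≡⟨ +-identityʳ _ ⟩
    ∑ (λ a → u (L↑ a) *ᶠ δ a b) ≡⟨ ∑-δʳ (λ a → u (L↑ a)) b ⟩
    u (L↑ b) ∎
    where open ≡-Reasoning

  halfForm : V N → V N → Carrier
  halfForm u v = ∑ (λ b → u (L↑ b) *ᶠ v (R↑ b))

  form≡halfForm-halfForm : ∀ u v → form u v ≡ halfForm u v +ᶠ -ᶠ halfForm v u
  form≡halfForm-halfForm u v = begin
    ∑ (λ l → uK u l *ᶠ v l) ≡⟨ ∑-++ {ν} {ν} (λ l → uK u l *ᶠ v l) ⟩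
    ∑ (λ b → uK u (L↑ b) *ᶠ v (L↑ b)) +ᶠ ∑ (λ b → uK u (R↑ b) *ᶠ v (R↑ b))
      ≡⟨ cong₂ _+ᶠ_ (∑-cong {ν} (λ b → trans (cong (_*ᶠ v (L↑ b)) (uK-l u b)) (trans (neg-*ˡ _ _) (cong -ᶠ_ (*-comm _ _)))))
                    (∑-cong {ν} (λ b → cong (_*ᶠ v (R↑ b)) (uK-r u b))) ⟩
    ∑ (λ b → -ᶠ (v (L↑ b) *ᶠ u (R↑ b))) +ᶠ halfForm u v ≡⟨ cong (_+ᶠ halfForm u v) (∑-neg (λ b → v (L↑ b) *ᶠ u (R↑ b))) ⟩
    -ᶠ halfForm v u +ᶠ halfForm u v ≡⟨ +-comm _ _ ⟩
    halfForm u v +ᶠ -ᶠ halfForm v u ∎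
    where open ≡-Reasoning

  form-alternating : ∀ u → form u u ≡ 0ᶠ
  form-alternating u = trans (form≡halfForm-halfForm u u) (-‿inverseʳ _)

  form-antisym : ∀ u v → form u v ≡ -ᶠ form v u
  form-antisym u v = trans (form≡halfForm-halfForm u v) (+-inverseʳ-unique (form v u) _ (begin
    form v u +ᶠ (halfForm u v +ᶠ -ᶠ halfForm v u) ≡⟨ cong (_+ᶠ (halfForm u v +ᶠ -ᶠ halfForm v u)) (form≡halfForm-halfForm v u) ⟩
    (halfForm v u +ᶠ -ᶠ halfForm u v) +ᶠ (halfForm u v +ᶠ -ᶠ halfForm v u)
      ≡⟨ solve 4 (λ a b c d → ((a :+ b) :+ (c :+ d)) := ((a :+ d) :+ (c :+ b))) refl _ _ _ _ ⟩
    (halfForm v u +ᶠ -ᶠ halfForm v u) +ᶠ (halfForm u v +ᶠ -ᶠ halfForm u v) ≡⟨ cong₂ _+ᶠ_ (-‿inverseʳ _) (-‿inverseʳ _) ⟩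
    0ᶠ +ᶠ 0ᶠ ≡⟨ +-identityˡ _ ⟩
    0ᶠ ∎))
    where open ≡-Reasoning

  form-⊥-sym : ∀ u v → form u v ≡ 0ᶠ → form v u ≡ 0ᶠ
  form-⊥-sym u v e = trans (form-antisym v u) (trans (cong -ᶠ_ e) -0#≈0#)

  unit : ∀ {n} → Fin n → V n
  unit i j = δ i j

  form-unit : ∀ u l → form u (unit l) ≡ uK u l
  form-unit u l = trans (∑-cong {N} (λ j → cong (uK u j *ᶠ_) (δ-sym l j))) (∑-δʳ (uK u) l)

  form-nondegenerate : ∀ u → (∀ l → form u (unit l) ≡ 0ᶠ) → ∀ j → u j ≡ 0ᶠ
  form-nondegenerate u h j with splitAt ν j in eq
  ... | inj₁ b = subst (λ t → u t ≡ 0ᶠ) (FinP.splitAt⁻¹-↑ˡ eq) (trans (sym (uK-r u b)) (trans (sym (form-unit u (R↑ b))) (h (R↑ b))))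
  ... | inj₂ b = subst (λ t → u t ≡ 0ᶠ) (FinP.splitAt⁻¹-↑ʳ eq)
         (trans (sym (-‿involutive _)) (trans (cong -ᶠ_ (trans (sym (uK-l u b)) (trans (sym (form-unit u (L↑ b))) (h (L↑ b))))) -0#≈0#))

  form-lcˡ : ∀ {m} (c : Fin m → Carrier) (A : Mat m N) v → form (lc c A) v ≡ ∑ (λ i → c i *ᶠ form (A i) v)
  form-lcˡ c A v = trans (·-congˡ (ᵗ (row v)) (·-assoc (row c) A K) Fin.zero Fin.zero)
                         (·-assoc (row c) (A · K) (ᵗ (row v)) Fin.zero Fin.zero)

  form-lcʳ : ∀ {m} (c : Fin m → Carrier) (A : Mat m N) u → form u (lc c A) ≡ ∑ (λ i → form u (A i) *ᶠ c i)
  form-lcʳ c A u = trans (·-congʳ (row u · K) (ᵗ-· (row c) A) Fin.zero Fin.zero)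
                         (sym (·-assoc (row u · K) (ᵗ A) (ᵗ (row c)) Fin.zero Fin.zero))

  form-ext : ∀ {u u' v v'} → (∀ j → u j ≡ u' j) → (∀ j → v j ≡ v' j) → form u v ≡ form u' v'
  form-ext eu ev = ∑-cong {N} (λ l → cong₂ _*ᶠ_ (∑-cong {N} (λ m → cong (_*ᶠ K m l) (eu m))) (ev l))

  form-+ˡ : ∀ u w v → form (λ j → u j +ᶠ w j) v ≡ form u v +ᶠ form w v
  form-+ˡ u w v = trans (∑-cong {N} (λ l → trans (cong (_*ᶠ v l) (trans (∑-cong {N} (λ m → distribʳ _ _ _)) (∑-+ (λ m → u m *ᶠ K m l) (λ m → w m *ᶠ K m l)))) (distribʳ _ _ _)))
    (∑-+ (λ l → uK u l *ᶠ v l) (λ l → uK w l *ᶠ v l))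

  form-*ˡ : ∀ a u v → form (λ j → a *ᶠ u j) v ≡ a *ᶠ form u v
  form-*ˡ a u v = trans (∑-cong {N} (λ l → trans (cong (_*ᶠ v l) (trans (∑-cong {N} (λ m → *-assoc _ _ _)) (∑-*ˡ a (λ m → u m *ᶠ K m l)))) (*-assoc _ _ _)))
    (∑-*ˡ a (λ l → uK u l *ᶠ v l))

  form-negˡ : ∀ u v → form (λ j → -ᶠ u j) v ≡ -ᶠ form u v
  form-negˡ u v = trans (∑-cong {N} (λ l → trans (cong (_*ᶠ v l) (trans (∑-cong {N} (λ m → neg-*ˡ _ _)) (∑-neg (λ m → u m *ᶠ K m l)))) (neg-*ˡ _ _)))
    (∑-neg (λ l → uK u l *ᶠ v l))

  form-+ʳ : ∀ u w v → form v (λ j → u j +ᶠ w j) ≡ form v u +ᶠ form v w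
  form-+ʳ u w v = trans (∑-cong {N} (λ l → distribˡ _ _ _)) (∑-+ (λ l → uK v l *ᶠ u l) (λ l → uK v l *ᶠ w l))

  form-*ʳ : ∀ a u v → form v (λ j → a *ᶠ u j) ≡ a *ᶠ form v u
  form-*ʳ a u v = trans (∑-cong {N} (λ l → solve 3 (λ x y z → (x :* (y :* z)) := (y :* (x :* z))) refl _ _ _)) (∑-*ˡ a (λ l → uK v l *ᶠ u l))

  form-0ˡ : ∀ v → form (λ _ → 0ᶠ) v ≡ 0ᶠ
  form-0ˡ v = trans (∑-cong {N} (λ l → trans (cong (_*ᶠ v l) (∑-zero {N} (λ m → zeroˡ _))) (zeroˡ _))) (∑-zero {N} (λ _ → refl))

  ·K-indep : ∀ {m} (L : Mat m N) → LinIndepRows L → LinIndepRows (L · K)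
  ·K-indep L ind c h = ind c (form-nondegenerate (lc c L) (λ l → trans (form-unit (lc c L) l) (trans (·-assoc (row c) L K Fin.zero l) (h l))))

  form-solvable : ∀ {m} (L : Mat m N) → LinIndepRows L → (b : Fin m → Carrier) → Σ (V N) λ v → ∀ x → form (L x) v ≡ b x
  form-solvable {m} L ind b = v , sol
    where
      M = L · K
      X = extend {N} (λ _ → ⊤) (λ _ → yes tt) (λ _ _ _ t → t) M (·K-indep L ind)
      open Extension X renaming (size to e; rows to E; indep to Eind; spans-S to spanS)
      B = E ++ M
      RR = invertible-of-basis B Eind (λ v → spanS v tt)
      R = proj₁ RR
      b' : Fin (e ℕ.+ m) → Carrier
      b' = _++_ {m = e} (λ _ → 0ᶠ) b
      v : V N
      v j = ∑ (λ y → R j y *ᶠ b' y)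
      sol : ∀ x → form (L x) v ≡ b x
      sol x = begin
        ∑ (λ l → M x l *ᶠ v l) ≡⟨ ∑-cong {N} (λ l → cong₂ _*ᶠ_ (cong (λ t → t l) (sym (lookup-++ʳ E M x))) refl) ⟩
        ∑ (λ l → B (e ↑ʳ x) l *ᶠ ∑ (λ y → R l y *ᶠ b' y))
          ≡⟨ ∑-cong {N} (λ l → trans (sym (∑-*ˡ (B (e ↑ʳ x) l) (λ y → R l y *ᶠ b' y))) (∑-cong {e ℕ.+ m} (λ y → sym (*-assoc _ _ _)))) ⟩
        ∑ (λ l → ∑ (λ y → B (e ↑ʳ x) l *ᶠ R l y *ᶠ b' y)) ≡⟨ ∑-swap (λ l y → B (e ↑ʳ x) l *ᶠ R l y *ᶠ b' y) ⟩
        ∑ (λ y → ∑ (λ l → B (e ↑ʳ x) l *ᶠ R l y *ᶠ b' y)) ≡⟨ ∑-cong {e ℕ.+ m} (λ y → ∑-*ʳ (b' y) (λ l → B (e ↑ʳ x) l *ᶠ R l y)) ⟩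
        ∑ (λ y → (B · R) (e ↑ʳ x) y *ᶠ b' y) ≡⟨ ∑-cong {e ℕ.+ m} (λ y → cong (_*ᶠ b' y) (proj₁ (proj₂ RR) (e ↑ʳ x) y)) ⟩
        ∑ (λ y → δ (e ↑ʳ x) y *ᶠ b' y) ≡⟨ ∑-δˡ b' (e ↑ʳ x) ⟩
        b' (e ↑ʳ x) ≡⟨ lookup-++ʳ {m = e} (λ _ → 0ᶠ) b x ⟩
        b x ∎
        where open ≡-Reasoning

  -- Gram matrices and types

  Gram : ∀ {m} → Mat m N → Mat m m
  Gram P = (P · K) · ᵗ P

  gram-·-symplectic : ∀ {m k} (A : Mat m N) (B : Mat k N) (T : Mat N N) → IsSymplectic T → (((A · T) · K) · ᵗ (B · T)) ≐ ((A · K) · ᵗ B)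
  gram-·-symplectic A B T symp = begin
    ((A · T) · K) · ᵗ (B · T)      ≈⟨ ·-congʳ ((A · T) · K) (ᵗ-· B T) ⟩
    ((A · T) · K) · (ᵗ T · ᵗ B)    ≈⟨ ·-assoc ((A · T) · K) (ᵗ T) (ᵗ B) ⟨
    (((A · T) · K) · ᵗ T) · ᵗ B    ≈⟨ ·-congˡ (ᵗ B) (·-congˡ (ᵗ T) (·-assoc A T K)) ⟩
    ((A · (T · K)) · ᵗ T) · ᵗ B    ≈⟨ ·-congˡ (ᵗ B) (·-assoc A (T · K) (ᵗ T)) ⟩
    (A · ((T · K) · ᵗ T)) · ᵗ B    ≈⟨ ·-congˡ (ᵗ B) (·-congʳ A symp) ⟩
    (A · K) · ᵗ B                  ∎
    where open ≐-Reasoning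

  type-unique : ∀ {m} (P : Mat m N) {d s d' s'} → HasType P d s → HasType P d' s' → (d ≡ d') × (s ≡ s')
  type-unique P (h1 , h2) (h1' , h2') = rank-unique P h1 h1' , ℕP.*-cancelˡ-≡ _ _ 2 (rank-unique (Gram P) h2 h2')

  gram-· : ∀ {d m} (B : Mat d N) (C : Mat m d) → Gram (C · B) ≐ ((C · Gram B) · ᵗ C)
  gram-· B C = begin
    ((C · B) · K) · ᵗ (C · B)      ≈⟨ ·-congʳ ((C · B) · K) (ᵗ-· C B) ⟩
    ((C · B) · K) · (ᵗ B · ᵗ C)    ≈⟨ ·-assoc ((C · B) · K) (ᵗ B) (ᵗ C) ⟨
    (((C · B) · K) · ᵗ B) · ᵗ C    ≈⟨ ·-congˡ (ᵗ C) (·-congˡ (ᵗ B) (·-assoc C B K)) ⟩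
    ((C · (B · K)) · ᵗ B) · ᵗ C    ≈⟨ ·-congˡ (ᵗ C) (·-assoc C (B · K) (ᵗ B)) ⟩
    (C · Gram B) · ᵗ C             ∎
    where open ≐-Reasoning

  gram-ext : ∀ {m} {A A' : Mat m N} → A ≐ A' → Gram A ≐ Gram A'
  gram-ext {A = A} {A'} e i j = form-ext (e i) (e j)

  -- With Y = C B and B = D Y we get D C = I and Gram Y = C (Gram B) ᵗC; a basis E of the row space
  -- of Gram B then yields the basis E ᵗC of that of Gram Y, independent because ᵗC ᵗD = I.
  gram-rank-transfer : ∀ {d m r} (B : Mat d N) (Y : Mat m N) → LinIndepRows B → SameRowSpace B Y → HasRank (Gram B) r → HasRank (Gram Y) r
  gram-rank-transfer B Y indB (B⊆Y , Y⊆B) (E , indE , E⊆GB , GB⊆E) = E · ᵗ C , indE·ᵗC , E·ᵗC⊆GY , GY⊆E·ᵗC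
    where
      open ≐-Reasoning
      C = coeffs Y⊆B
      D = coeffs B⊆Y
      P = coeffs E⊆GB
      Q = coeffs GB⊆E
      DC : (D · C) ≐ Iᵐ
      DC = coeffs-leftInverse B Y C D indB (coeffs-eq Y⊆B) (coeffs-eq B⊆Y)
      GY : Gram Y ≐ ((C · Gram B) · ᵗ C)
      GY = ≐-trans (gram-ext (coeffs-eq Y⊆B)) (gram-· B C)
      GB·ᵗC : (Gram B · ᵗ C) ≐ (D · Gram Y)
      GB·ᵗC = begin
        Gram B · ᵗ C                ≈⟨ ·-congˡ (ᵗ C) (I-· (Gram B)) ⟨
        (Iᵐ · Gram B) · ᵗ C         ≈⟨ ·-congˡ (ᵗ C) (·-congˡ (Gram B) DC) ⟨
        ((D · C) · Gram B) · ᵗ C    ≈⟨ ·-congˡ (ᵗ C) (·-assoc D C (Gram B)) ⟩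
        (D · (C · Gram B)) · ᵗ C    ≈⟨ ·-assoc D (C · Gram B) (ᵗ C) ⟩
        D · ((C · Gram B) · ᵗ C)    ≈⟨ ·-congʳ D GY ⟨
        D · Gram Y                  ∎
      E·ᵗC⊆GY : ∀ i → InRowSpace ((E · ᵗ C) i) (Gram Y)
      E·ᵗC⊆GY = span-of-· (P · D) (Gram Y) (begin
        E · ᵗ C               ≈⟨ ·-congˡ (ᵗ C) (coeffs-eq E⊆GB) ⟩
        (P · Gram B) · ᵗ C    ≈⟨ ·-assoc P (Gram B) (ᵗ C) ⟩
        P · (Gram B · ᵗ C)    ≈⟨ ·-congʳ P GB·ᵗC ⟩
        P · (D · Gram Y)      ≈⟨ ·-assoc P D (Gram Y) ⟨
        (P · D) · Gram Y      ∎)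
      GY⊆E·ᵗC : ∀ i → InRowSpace (Gram Y i) (E · ᵗ C)
      GY⊆E·ᵗC = span-of-· (C · Q) (E · ᵗ C) (begin
        Gram Y                ≈⟨ GY ⟩
        (C · Gram B) · ᵗ C    ≈⟨ ·-congˡ (ᵗ C) (·-congʳ C (coeffs-eq GB⊆E)) ⟩
        (C · (Q · E)) · ᵗ C   ≈⟨ ·-congˡ (ᵗ C) (·-assoc C Q E) ⟨
        ((C · Q) · E) · ᵗ C   ≈⟨ ·-assoc (C · Q) E (ᵗ C) ⟩
        (C · Q) · (E · ᵗ C)   ∎)
      ᵗC·ᵗD : (ᵗ C · ᵗ D) ≐ Iᵐ
      ᵗC·ᵗD = ≐-trans (≐-sym (ᵗ-· D C)) (≐-trans (ᵗ-ext DC) ᵗI)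
      indE·ᵗC : LinIndepRows (E · ᵗ C)
      indE·ᵗC = indep-·-invertible E (ᵗ C) (ᵗ D) ᵗC·ᵗD indE

  hasType-of-basis : ∀ {d m s} (B : Mat d N) (Y : Mat m N) → LinIndepRows B → SameRowSpace B Y → HasRank (Gram B) (2 ℕ.* s) → HasType Y d s
  hasType-of-basis B Y indB sBY hg = (B , indB , sBY) , gram-rank-transfer B Y indB sBY hg

  -- Symplectic matrices

  symplectic-indep : (T : Mat N N) → IsSymplectic T → LinIndepRows T
  symplectic-indep T symp c h = form-nondegenerate c (λ l → trans (form-unit c l) (begin
    ∑ (λ m → c m *ᶠ K m l) ≡⟨ ∑-cong {N} (λ m → cong (c m *ᶠ_) (sym (symp m l))) ⟩
    ∑ (λ m → c m *ᶠ form (T m) (T l)) ≡⟨ sym (form-lcˡ c T (T l)) ⟩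
    form (lc c T) (T l) ≡⟨ form-ext h (λ _ → refl) ⟩
    form (λ _ → 0ᶠ) (T l) ≡⟨ form-0ˡ _ ⟩
    0ᶠ ∎))
    where open ≡-Reasoning

  record SymplecticInverse (T : Mat N N) : Set where
    field
      R : Mat N N
      TR : (T · R) ≐ Iᵐ
      RT : (R · T) ≐ Iᵐ
      Rsymp : IsSymplectic R

  symplectic-inverse : (T : Mat N N) → IsSymplectic T → SymplecticInverse T
  symplectic-inverse T symp = record { R = R ; TR = TR ; RT = RT ; Rsymp = Rs }
    where
      indT = symplectic-indep T symp
      RR = invertible-of-basis T indT (indep-spans-all T indT ℕP.≤-refl)
      R = proj₁ RR
      TR = proj₁ (proj₂ RR)
      RT = proj₂ (proj₂ RR)
      Rs : IsSymplectic R
      Rs = begin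
        (R · K) · ᵗ R                ≈⟨ gram-·-symplectic R R T symp ⟨
        ((R · T) · K) · ᵗ (R · T)    ≈⟨ ·-congˡ (ᵗ (R · T)) (·-congˡ K RT) ⟩
        (Iᵐ · K) · ᵗ (R · T)         ≈⟨ ·-congʳ (Iᵐ · K) (≐-trans (ᵗ-ext RT) ᵗI) ⟩
        (Iᵐ · K) · Iᵐ                ≈⟨ ·-I (Iᵐ · K) ⟩
        Iᵐ · K                       ≈⟨ I-· K ⟩
        K                            ∎
        where open ≐-Reasoning

  symplectic-· : (T1 T2 : Mat N N) → IsSymplectic T1 → IsSymplectic T2 → IsSymplectic (T1 · T2)
  symplectic-· T1 T2 s1 s2 = ≐-trans (gram-·-symplectic T1 T1 T2 s2) s1

  HasRank-ext : ∀ {m n r} {A A' : Mat m n} → HasRank A r → A ≐ A' → HasRank A' r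
  HasRank-ext (E , ind , s) e = E , ind , SRS-trans s (SRS-ext e)

  -- Unlike HasType, this can be transported along symplectic maps: gram-rank-transfer needs
  -- independent rows.
  record TypedBasis {m} (P : Mat m N) (d s : ℕ) : Set where
    field
      rows : Mat d N
      rows-indep : LinIndepRows rows
      gram-rank : HasRank (Gram rows) (2 ℕ.* s)
      spans : SameRowSpace rows P

  typedBasis⇒hasType : ∀ {m d s} {P : Mat m N} → TypedBasis P d s → HasType P d s
  typedBasis⇒hasType {s = s} {P} b = hasType-of-basis {s = s} rows P rows-indep spans gram-rank
    where open TypedBasis b

  typedBasis-resp : ∀ {m m′ d s} {P : Mat m N} {Q : Mat m′ N} → TypedBasis P d s → SameRowSpace P Q → TypedBasis Q d s
  typedBasis-resp b P≈Q = record { rows = rows ; rows-indep = rows-indep ; gram-rank = gram-rank ; spans = SRS-trans spans P≈Q }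
    where open TypedBasis b

  typedBasis-· : ∀ {m m′ d s} {P : Mat m N} {Q : Mat m′ N} (T : Mat N N) → IsSymplectic T →
    TypedBasis P d s → SameRowSpace (P · T) Q → TypedBasis Q d s
  typedBasis-· T symp b PT≈Q = record
    { rows = rows · T
    ; rows-indep = indep-·-invertible rows T (SymplecticInverse.R T⁻¹) (SymplecticInverse.TR T⁻¹) rows-indep
    ; gram-rank = HasRank-ext gram-rank (≐-sym (gram-·-symplectic rows rows T symp))
    ; spans = SRS-trans (SRS-· T spans) PT≈Q }
    where
      open TypedBasis b
      T⁻¹ = symplectic-inverse T symp

  sameType-· : ∀ {m m′ d s} {P : Mat m N} {Q : Mat m′ N} (T : Mat N N) → IsSymplectic T →
    TypedBasis P d s → SameRowSpace (P · T) Q → SameType P Q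
  sameType-· {d = d} {s} T symp b PT≈Q = d , s , typedBasis⇒hasType b , typedBasis⇒hasType (typedBasis-· T symp b PT≈Q)

  sameType⇒≡ : ∀ {m m′ d d′ s s′} {P : Mat m N} {Q : Mat m′ N} →
    TypedBasis P d s → TypedBasis Q d′ s′ → SameType P Q → (d ≡ d′) × (s ≡ s′)
  sameType⇒≡ {s = s} {s′} {P} {Q} bP bQ (_ , s₀ , hP , hQ)
    with type-unique P {s = s} {s' = s₀} (typedBasis⇒hasType bP) hP | type-unique Q {s = s′} {s' = s₀} (typedBasis⇒hasType bQ) hQ
  ... | d≡ , s≡ | d′≡ , s′≡ = trans d≡ (sym d′≡) , trans s≡ (sym s′≡)

  -- Hyperbolic pairs

  record HyperbolicPairs (p : ℕ) : Set where
    field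
      u w : Mat p N
      uu : ∀ a b → form (u a) (u b) ≡ 0ᶠ
      ww : ∀ a b → form (w a) (w b) ≡ 0ᶠ
      uw : ∀ a b → form (u a) (w b) ≡ δ a b

  module PairLemmas {p : ℕ} (H : HyperbolicPairs p) where
    open HyperbolicPairs H
    G : Mat (p ℕ.+ p) N
    G = u ++ w

    wu : ∀ a b → form (w a) (u b) ≡ -ᶠ δ b a
    wu a b = trans (form-antisym (w a) (u b)) (cong -ᶠ_ (uw b a))

    form-lc-pairs-w : ∀ (a : Fin (p ℕ.+ p) → Carrier) b → form (lc a G) (w b) ≡ a (b ↑ˡ p)
    form-lc-pairs-w a b = begin
      form (lc a G) (w b) ≡⟨ form-lcˡ a G (w b) ⟩
      ∑ (λ z → a z *ᶠ form (G z) (w b)) ≡⟨ ∑-++ {p} {p} (λ z → a z *ᶠ form (G z) (w b)) ⟩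
      ∑ (λ x → a (x ↑ˡ p) *ᶠ form (G (x ↑ˡ p)) (w b)) +ᶠ ∑ (λ x → a (p ↑ʳ x) *ᶠ form (G (p ↑ʳ x)) (w b))
        ≡⟨ cong₂ _+ᶠ_ (∑-cong {p} (λ x → cong (a (x ↑ˡ p) *ᶠ_) (trans (cong (λ t → form t (w b)) (lookup-++ˡ u w x)) (uw x b))))
                      (∑-zero {p} (λ x → zeroʳ-≡ _ _ (trans (cong (λ t → form t (w b)) (lookup-++ʳ u w x)) (ww x b)))) ⟩
      ∑ (λ x → a (x ↑ˡ p) *ᶠ δ x b) +ᶠ 0ᶠ ≡⟨ +-identityʳ-≡ _ _ refl ⟩
      ∑ (λ x → a (x ↑ˡ p) *ᶠ δ x b) ≡⟨ ∑-δʳ (λ x → a (x ↑ˡ p)) b ⟩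
      a (b ↑ˡ p) ∎
      where open ≡-Reasoning

    form-lc-pairs-u : ∀ (a : Fin (p ℕ.+ p) → Carrier) b → form (lc a G) (u b) ≡ -ᶠ a (p ↑ʳ b)
    form-lc-pairs-u a b = begin
      form (lc a G) (u b) ≡⟨ form-lcˡ a G (u b) ⟩
      ∑ (λ z → a z *ᶠ form (G z) (u b)) ≡⟨ ∑-++ {p} {p} (λ z → a z *ᶠ form (G z) (u b)) ⟩
      ∑ (λ x → a (x ↑ˡ p) *ᶠ form (G (x ↑ˡ p)) (u b)) +ᶠ ∑ (λ x → a (p ↑ʳ x) *ᶠ form (G (p ↑ʳ x)) (u b))
        ≡⟨ cong₂ _+ᶠ_ (∑-zero {p} (λ x → zeroʳ-≡ _ _ (trans (cong (λ t → form t (u b)) (lookup-++ˡ u w x)) (uu x b))))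
                      (∑-cong {p} (λ x → trans (cong (a (p ↑ʳ x) *ᶠ_) (trans (cong (λ t → form t (u b)) (lookup-++ʳ u w x)) (wu x b)))
                                              (trans (neg-*ʳ _ _) (cong (λ t → -ᶠ (a (p ↑ʳ x) *ᶠ t)) (δ-sym b x))))) ⟩
      0ᶠ +ᶠ ∑ (λ x → -ᶠ (a (p ↑ʳ x) *ᶠ δ x b)) ≡⟨ +-identityˡ _ ⟩
      ∑ (λ x → -ᶠ (a (p ↑ʳ x) *ᶠ δ x b)) ≡⟨ ∑-neg (λ x → a (p ↑ʳ x) *ᶠ δ x b) ⟩
      -ᶠ ∑ (λ x → a (p ↑ʳ x) *ᶠ δ x b) ≡⟨ cong -ᶠ_ (∑-δʳ (λ x → a (p ↑ʳ x)) b) ⟩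
      -ᶠ a (p ↑ʳ b) ∎
      where open ≡-Reasoning

    pairs-coeffs-zero : ∀ (a : Fin (p ℕ.+ p) → Carrier) → (∀ b → form (lc a G) (w b) ≡ 0ᶠ) → (∀ b → form (lc a G) (u b) ≡ 0ᶠ) → ∀ z → a z ≡ 0ᶠ
    pairs-coeffs-zero a hw hu = ++-elim (λ z → a z ≡ 0ᶠ) (λ b → trans (sym (form-lc-pairs-w a b)) (hw b))
      (λ b → trans (sym (-‿involutive _)) (trans (cong -ᶠ_ (trans (sym (form-lc-pairs-u a b)) (hu b))) -0#≈0#))

    pairs-indep : LinIndepRows G
    pairs-indep a h = pairs-coeffs-zero a (λ b → trans (form-ext h (λ _ → refl)) (form-0ˡ _)) (λ b → trans (form-ext h (λ _ → refl)) (form-0ˡ _))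

  record IsotropicOver {p r : ℕ} (H : HyperbolicPairs p) (Rd : Mat r N) : Set where
    field
      ru : ∀ c b → form (Rd c) (HyperbolicPairs.u H b) ≡ 0ᶠ
      rw : ∀ c b → form (Rd c) (HyperbolicPairs.w H b) ≡ 0ᶠ
      rr : ∀ c c' → form (Rd c) (Rd c') ≡ 0ᶠ

  module PairsAndRadical {p r : ℕ} (H : HyperbolicPairs p) (Rd : Mat r N) (RO : IsotropicOver H Rd) where
    open HyperbolicPairs H
    open PairLemmas H
    open IsotropicOver RO
    basis : Mat ((p ℕ.+ p) ℕ.+ r) N
    basis = G ++ Rd

    rad-form : ∀ (c : Fin r → Carrier) v → (∀ x → form (Rd x) v ≡ 0ᶠ) → form (lc c Rd) v ≡ 0ᶠ
    rad-form c v h = trans (form-lcˡ c Rd v) (∑-zero {r} (λ x → zeroʳ-≡ _ _ (h x)))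

    basis-indep : LinIndepRows Rd → LinIndepRows basis
    basis-indep indR c h = ++-elim (λ z → c z ≡ 0ᶠ) cG0 cR0
      where
        cG = λ z → c (z ↑ˡ r)
        cR = λ x → c ((p ℕ.+ p) ↑ʳ x)
        split : ∀ j → lc c basis j ≡ lc cG G j +ᶠ lc cR Rd j
        split j = lc-++ c G Rd j
        fz : ∀ v → form (lc cG G) v +ᶠ form (lc cR Rd) v ≡ 0ᶠ
        fz v = trans (sym (form-+ˡ (lc cG G) (lc cR Rd) v)) (trans (form-ext (λ j → trans (sym (split j)) (h j)) (λ _ → refl)) (form-0ˡ v))
        cG0 : ∀ z → c (z ↑ˡ r) ≡ 0ᶠ
        cG0 = pairs-coeffs-zero cG (λ b → trans (sym (+-identityʳ-≡ _ _ (rad-form cR (w b) (λ x → rw x b)))) (fz (w b)))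
                            (λ b → trans (sym (+-identityʳ-≡ _ _ (rad-form cR (u b) (λ x → ru x b)))) (fz (u b)))
        cR0 : ∀ x → c ((p ℕ.+ p) ↑ʳ x) ≡ 0ᶠ
        cR0 = indR cR (λ j → trans (sym (+-identityˡ _)) (trans (cong (_+ᶠ lc cR Rd j) (sym (∑-zero {p ℕ.+ p} (λ z → zeroˡ-≡ _ _ (cG0 z))))) (trans (sym (split j)) (h j))))

    basis-radical : ∀ x y → form (basis ((p ℕ.+ p) ↑ʳ x)) (basis y) ≡ 0ᶠ
    basis-radical x y = trans (cong (λ t → form t (basis y)) (lookup-++ʳ G Rd x))
      (++-elim (λ y → form (Rd x) (basis y) ≡ 0ᶠ)
        (λ z → trans (cong (form (Rd x)) (lookup-++ˡ G Rd z)) (++-elim (λ z → form (Rd x) (G z) ≡ 0ᶠ)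
            (λ b → trans (cong (form (Rd x)) (lookup-++ˡ u w b)) (ru x b))
            (λ b → trans (cong (form (Rd x)) (lookup-++ʳ u w b)) (rw x b)) z))
        (λ c' → trans (cong (form (Rd x)) (lookup-++ʳ G Rd c')) (rr x c')) y)

    gramRows : Mat (p ℕ.+ p) ((p ℕ.+ p) ℕ.+ r)
    gramRows z y = form (G z) (basis y)

    gramRows-indep : LinIndepRows gramRows
    gramRows-indep a h = pairs-coeffs-zero a
      (λ b → trans (cong (form (lc a G)) (sym (trans (lookup-++ˡ G Rd (p ↑ʳ b)) (lookup-++ʳ u w b)))) (trans (form-lcˡ a G _) (h _)))
      (λ b → trans (cong (form (lc a G)) (sym (trans (lookup-++ˡ G Rd (b ↑ˡ p)) (lookup-++ˡ u w b)))) (trans (form-lcˡ a G _) (h _)))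

    -- The radical rows of Gram basis vanish and the rows of the pairs are independent.
    gram-basis-rank′ : HasRank (Gram basis) (p ℕ.+ p)
    gram-basis-rank′ = gramRows , gramRows-indep , (sEG , sGE)
      where
        sEG : ∀ z → InRowSpace (gramRows z) (Gram basis)
        sEG z = span-ext (Gram basis) (λ y → cong (λ t → form t (basis y)) (lookup-++ˡ G Rd z)) (span-row (Gram basis) (z ↑ˡ r))
        sGE : ∀ x → InRowSpace (Gram basis x) gramRows
        sGE = ++-elim (λ x → InRowSpace (Gram basis x) gramRows)
          (λ z → span-ext gramRows (λ y → cong (λ t → form t (basis y)) (sym (lookup-++ˡ G Rd z))) (span-row gramRows z))
          (λ c → span-ext gramRows (λ y → sym (basis-radical c y)) (span-zero gramRows))

    gram-basis-rank : HasRank (Gram basis) (2 ℕ.* p)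
    gram-basis-rank = subst (HasRank (Gram basis)) (cong (p ℕ.+_) (sym (ℕP.+-identityʳ p))) gram-basis-rank′

  snoc : ∀ {p} {A : Set} → (Fin p → A) → A → Fin (suc p) → A
  snoc {zero} f x Fin.zero = x
  snoc {suc p} f x Fin.zero = f Fin.zero
  snoc {suc p} f x (Fin.suc i) = snoc (λ t → f (Fin.suc t)) x i

  snoc-inj : ∀ {p} {A : Set} (f : Fin p → A) x a → snoc f x (inject₁ a) ≡ f a
  snoc-inj {suc p} f x Fin.zero = refl
  snoc-inj {suc p} f x (Fin.suc a) = snoc-inj (λ t → f (Fin.suc t)) x a

  snoc-last : ∀ {p} {A : Set} (f : Fin p → A) x → snoc f x (fromℕ p) ≡ x
  snoc-last {zero} f x = refl
  snoc-last {suc p} f x = snoc-last (λ t → f (Fin.suc t)) x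

  snoc-elim : ∀ {p} (P : Fin (suc p) → Set) → (∀ a → P (inject₁ a)) → P (fromℕ p) → ∀ i → P i
  snoc-elim {zero} P f l Fin.zero = l
  snoc-elim {suc p} P f l Fin.zero = f Fin.zero
  snoc-elim {suc p} P f l (Fin.suc i) = snoc-elim (λ t → P (Fin.suc t)) (λ a → f (Fin.suc a)) l i

  extendPairs : ∀ {p} (H : HyperbolicPairs p) (x y : V N) →
    (∀ a → form x (HyperbolicPairs.u H a) ≡ 0ᶠ) → (∀ a → form x (HyperbolicPairs.w H a) ≡ 0ᶠ) →
    (∀ a → form y (HyperbolicPairs.u H a) ≡ 0ᶠ) → (∀ a → form y (HyperbolicPairs.w H a) ≡ 0ᶠ) → form x y ≡ 1ᶠ → HyperbolicPairs (suc p)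
  extendPairs {p} H x y xu xw yu yw xy = record { u = u' ; w = w' ; uu = uu' ; ww = ww' ; uw = uw' }
    where
      open HyperbolicPairs H
      u' = snoc u x
      w' = snoc w y
      uu' : ∀ a b → form (u' a) (u' b) ≡ 0ᶠ
      uu' = snoc-elim _ (λ a → snoc-elim _ (λ b → trans (cong₂ form (snoc-inj u x a) (snoc-inj u x b)) (uu a b))
                                        (trans (cong₂ form (snoc-inj u x a) (snoc-last u x)) (form-⊥-sym x (u a) (xu a))))
                         (snoc-elim _ (λ b → trans (cong₂ form (snoc-last u x) (snoc-inj u x b)) (xu b))
                                        (trans (cong₂ form (snoc-last u x) (snoc-last u x)) (form-alternating x)))
      ww' : ∀ a b → form (w' a) (w' b) ≡ 0ᶠ
      ww' = snoc-elim _ (λ a → snoc-elim _ (λ b → trans (cong₂ form (snoc-inj w y a) (snoc-inj w y b)) (ww a b))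
                                        (trans (cong₂ form (snoc-inj w y a) (snoc-last w y)) (form-⊥-sym y (w a) (yw a))))
                         (snoc-elim _ (λ b → trans (cong₂ form (snoc-last w y) (snoc-inj w y b)) (yw b))
                                        (trans (cong₂ form (snoc-last w y) (snoc-last w y)) (form-alternating y)))
      uw' : ∀ a b → form (u' a) (w' b) ≡ δ a b
      uw' = snoc-elim _ (λ a → snoc-elim _ (λ b → trans (cong₂ form (snoc-inj u x a) (snoc-inj w y b)) (trans (uw a b) (sym (δ-injective inject₁ FinP.inject₁-injective a b))))
                                        (trans (cong₂ form (snoc-inj u x a) (snoc-last w y)) (trans (form-⊥-sym y (u a) (yu a)) (sym (δ-inj-last a)))))
                         (snoc-elim _ (λ b → trans (cong₂ form (snoc-last u x) (snoc-inj w y b)) (trans (xw b) (sym (δ-last-inj b))))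
                                        (trans (cong₂ form (snoc-last u x) (snoc-last w y)) (trans xy (sym (δ-refl (fromℕ p))))))

  m+m≤n+n⇒m≤n : ∀ m n → m ℕ.+ m ≤ n ℕ.+ n → m ≤ n
  m+m≤n+n⇒m≤n m n le with m ℕP.≤? n
  ... | yes p = p
  ... | no np = ⊥-elim (ℕP.<⇒≱ (ℕP.+-mono-< (ℕP.≰⇒> np) (ℕP.≰⇒> np)) le)

  pairs-bound : ∀ {p} (H : HyperbolicPairs p) → p ≤ ν
  pairs-bound {p} H = m+m≤n+n⇒m≤n p ν (indep-bound (PairLemmas.G H) (PairLemmas.pairs-indep H))

  single : V N → Mat 1 N
  single x _ = x

  single-indep : ∀ x → ¬ (∀ j → x j ≡ 0ᶠ) → LinIndepRows (single x)
  single-indep x nz c h Fin.zero with c Fin.zero ≟ᶠ 0ᶠ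
  ... | yes e = e
  ... | no ne = ⊥-elim (nz (λ j → x*y≡0⇒y≡0 _ _ (trans (sym (+-identityʳ _)) (h j)) ne))

  module Projection {p} (H : HyperbolicPairs p) where
    open HyperbolicPairs H
    open PairLemmas H
    coords : V N → Fin (p ℕ.+ p) → Carrier
    coords v = _++_ {m = p} (λ x → form v (w x)) (λ x → -ᶠ form v (u x))
    perp : V N → V N
    perp v j = v j +ᶠ -ᶠ lc (coords v) G j

    perp-form : ∀ v t → form (perp v) t ≡ form v t +ᶠ -ᶠ form (lc (coords v) G) t
    perp-form v t = trans (form-+ˡ v (λ j → -ᶠ lc (coords v) G j) t) (cong (form v t +ᶠ_) (form-negˡ (lc (coords v) G) t))

    perp-w : ∀ v b → form (perp v) (w b) ≡ 0ᶠ
    perp-w v b = trans (perp-form v (w b)) (trans (cong (λ t → form v (w b) +ᶠ -ᶠ t) (trans (form-lc-pairs-w (coords v) b) (lookup-++ˡ {m = p} _ _ b))) (-‿inverseʳ _))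

    perp-u : ∀ v b → form (perp v) (u b) ≡ 0ᶠ
    perp-u v b = trans (perp-form v (u b))
      (trans (cong (λ t → form v (u b) +ᶠ -ᶠ t) (trans (form-lc-pairs-u (coords v) b) (trans (cong -ᶠ_ (lookup-++ʳ {m = p} _ _ b)) (-‿involutive _))))
             (-‿inverseʳ _))

    perp-decomp : ∀ v j → v j ≡ perp v j +ᶠ lc (coords v) G j
    perp-decomp v j = sym (trans (+-assoc _ _ _) (trans (cong (v j +ᶠ_) (-‿inverseˡ _)) (+-identityʳ _)))

  -- Witt extension: pairing off an isotropic family and completing to a symplectic basis

  record PairedRadical {p k} (H : HyperbolicPairs p) (Rd : Mat k N) : Set where
    field
      p' : ℕ
      H' : HyperbolicPairs p'
      eq : p' ≡ p ℕ.+ k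
      pres-u : ∀ i a → toℕ i ≡ toℕ a → HyperbolicPairs.u H' i ≡ HyperbolicPairs.u H a
      pres-w : ∀ i a → toℕ i ≡ toℕ a → HyperbolicPairs.w H' i ≡ HyperbolicPairs.w H a
      rad-u : ∀ i c → toℕ i ≡ p ℕ.+ toℕ c → HyperbolicPairs.u H' i ≡ Rd c

  indep-tail : ∀ {k n} (A : Mat (suc k) n) → LinIndepRows A → LinIndepRows (λ i → A (Fin.suc i))
  indep-tail A ind c h i = ind (_∷_ 0ᶠ c) (λ j → trans (cong (_+ᶠ ∑ (λ t → c t *ᶠ A (Fin.suc t) j)) (zeroˡ _)) (trans (+-identityˡ _) (h j))) (Fin.suc i)

  -- Solving form (Rd c) g = δ 0 c with g ⊥ all pairs gives a partner g of Rd 0; the other rows of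
  -- Rd stay isotropic over the enlarged family of pairs.
  pairRadical : ∀ k {p} (H : HyperbolicPairs p) (Rd : Mat k N) → IsotropicOver H Rd → LinIndepRows Rd → PairedRadical H Rd
  pairRadical zero {p} H Rd RO ind = record { p' = p ; H' = H ; eq = sym (ℕP.+-identityʳ p)
    ; pres-u = λ i a e → cong (HyperbolicPairs.u H) (FinP.toℕ-injective e) ; pres-w = λ i a e → cong (HyperbolicPairs.w H) (FinP.toℕ-injective e)
    ; rad-u = λ i () }
  pairRadical (suc k) {p} H Rd RO ind = record { p' = PairedRadical.p' rec ; H' = PairedRadical.H' rec ; eq = trans (PairedRadical.eq rec) (sym (ℕP.+-suc p k))
    ; pres-u = λ i a e → trans (PairedRadical.pres-u rec i (inject₁ a) (trans e (sym (FinP.toℕ-inject₁ a)))) (snoc-inj u x a)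
    ; pres-w = λ i a e → trans (PairedRadical.pres-w rec i (inject₁ a) (trans e (sym (FinP.toℕ-inject₁ a)))) (snoc-inj w g a)
    ; rad-u = radu }
    where
      open HyperbolicPairs H
      open PairLemmas H
      open IsotropicOver RO
      open PairsAndRadical H Rd RO
      pp = p ℕ.+ p
      b : Fin (pp ℕ.+ suc k) → Carrier
      b = _++_ {m = pp} (λ _ → 0ᶠ) (δ Fin.zero)
      sol = form-solvable basis (basis-indep ind) b
      g = proj₁ sol
      gu : ∀ a → form (u a) g ≡ 0ᶠ
      gu a = trans (cong (λ t → form t g) (sym (trans (lookup-++ˡ G Rd (a ↑ˡ p)) (lookup-++ˡ u w a)))) (trans (proj₂ sol ((a ↑ˡ p) ↑ˡ suc k)) (lookup-++ˡ {m = pp} _ _ (a ↑ˡ p)))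
      gw : ∀ a → form (w a) g ≡ 0ᶠ
      gw a = trans (cong (λ t → form t g) (sym (trans (lookup-++ˡ G Rd (p ↑ʳ a)) (lookup-++ʳ u w a)))) (trans (proj₂ sol ((p ↑ʳ a) ↑ˡ suc k)) (lookup-++ˡ {m = pp} _ _ (p ↑ʳ a)))
      gr : ∀ c → form (Rd c) g ≡ δ Fin.zero c
      gr c = trans (cong (λ t → form t g) (sym (lookup-++ʳ G Rd c))) (trans (proj₂ sol (pp ↑ʳ c)) (lookup-++ʳ {m = pp} (λ _ → 0ᶠ) (δ Fin.zero) c))
      x = Rd Fin.zero
      H1 = extendPairs H x g (ru Fin.zero) (rw Fin.zero) (λ a → form-⊥-sym (u a) g (gu a)) (λ a → form-⊥-sym (w a) g (gw a))
             (trans (gr Fin.zero) (δ-refl {suc k} Fin.zero))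
      R1-isotropic : IsotropicOver H1 (λ c → Rd (Fin.suc c))
      R1-isotropic = record
        { ru = λ c → snoc-elim _ (λ a → trans (cong (form (Rd (Fin.suc c))) (snoc-inj u x a)) (ru (Fin.suc c) a))
                                  (trans (cong (form (Rd (Fin.suc c))) (snoc-last u x)) (rr (Fin.suc c) Fin.zero))
        ; rw = λ c → snoc-elim _ (λ a → trans (cong (form (Rd (Fin.suc c))) (snoc-inj w g a)) (rw (Fin.suc c) a))
                                  (trans (cong (form (Rd (Fin.suc c))) (snoc-last w g)) (trans (gr (Fin.suc c)) (δ-≢ Fin.zero (Fin.suc c) (λ ()))))
        ; rr = λ c c' → rr (Fin.suc c) (Fin.suc c') }
      rec = pairRadical k H1 (λ c → Rd (Fin.suc c)) R1-isotropic (indep-tail Rd ind)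
      radu : ∀ i c → toℕ i ≡ p ℕ.+ toℕ c → HyperbolicPairs.u (PairedRadical.H' rec) i ≡ Rd c
      radu i Fin.zero e = trans (PairedRadical.pres-u rec i (fromℕ p) (trans e (trans (ℕP.+-identityʳ p) (sym (FinP.toℕ-fromℕ p))))) (snoc-last u x)
      radu i (Fin.suc c) e = PairedRadical.rad-u rec i c (trans e (ℕP.+-suc p (toℕ c)))

  record Completion {p} (H : HyperbolicPairs p) : Set where
    field
      p' : ℕ
      H' : HyperbolicPairs p'
      eq : p' ≡ ν
      pres-u : ∀ i a → toℕ i ≡ toℕ a → HyperbolicPairs.u H' i ≡ HyperbolicPairs.u H a
      pres-w : ∀ i a → toℕ i ≡ toℕ a → HyperbolicPairs.w H' i ≡ HyperbolicPairs.w H a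

  NonzeroPerp : ∀ {p} → HyperbolicPairs p → V N → Set
  NonzeroPerp H x = (¬ (∀ j → x j ≡ 0ᶠ)) × ((∀ a → form x (HyperbolicPairs.u H a) ≡ 0ᶠ) × (∀ a → form x (HyperbolicPairs.w H a) ≡ 0ᶠ))

  nonzeroPerp? : ∀ {p} (H : HyperbolicPairs p) → Dec (Σ (V N) (NonzeroPerp H))
  nonzeroPerp? H = any-vector? N (NonzeroPerp H)
    (λ x x' e (nz , xu , xw) → (λ all0 → nz (λ j → trans (e j) (all0 j))) ,
        (λ a → trans (form-ext (λ j → sym (e j)) (λ _ → refl)) (xu a)) , (λ a → trans (form-ext (λ j → sym (e j)) (λ _ → refl)) (xw a)))
    (λ x → ¬? (FinP.all? (λ j → x j ≟ᶠ 0ᶠ)) ×-dec FinP.all? (λ a → form x (HyperbolicPairs.u H a) ≟ᶠ 0ᶠ) ×-dec FinP.all? (λ a → form x (HyperbolicPairs.w H a) ≟ᶠ 0ᶠ))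

  pairs-span-all : ∀ {p} (H : HyperbolicPairs p) → ¬ Σ (V N) (NonzeroPerp H) → ∀ v → InRowSpace v (PairLemmas.G H)
  pairs-span-all H np v with FinP.all? (λ j → Projection.perp H v j ≟ᶠ 0ᶠ)
  ... | yes all0 = coords v , λ j → trans (perp-decomp v j) (trans (cong (_+ᶠ lc (coords v) G j) (all0 j)) (+-identityˡ _))
    where open Projection H
          open PairLemmas H
  ... | no nz = ⊥-elim (np (perp v , nz , perp-u v , perp-w v))
    where open Projection H

  -- A nonzero x orthogonal to all pairs gets a partner y by solving form x y = 1 with y ⊥ all pairs.
  -- When no such x exists the pairs span F^(2ν), so there are already ν of them.
  completePairs : ∀ f {p} (H : HyperbolicPairs p) → p ℕ.+ f ≡ ν → Completion H
  completePairs f {p} H e with nonzeroPerp? H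
  completePairs zero {p} H e | no np = record { p' = p ; H' = H ; eq = trans (sym (ℕP.+-identityʳ p)) e
    ; pres-u = λ i a e → cong (HyperbolicPairs.u H) (FinP.toℕ-injective e) ; pres-w = λ i a e → cong (HyperbolicPairs.w H) (FinP.toℕ-injective e) }
  completePairs (suc f) {p} H e | no np = ⊥-elim (ℕP.<⇒≱ lt (steinitz (p ℕ.+ p) (PairLemmas.G H) Iᵐ (λ i → pairs-span-all H np (Iᵐ i)) Iᵐ-indep))
    where
      lt : p ℕ.+ p ℕ.< ν ℕ.+ ν
      lt = ℕP.+-mono-< (subst (p ℕ.<_) e (ℕP.m<m+n p (s≤s z≤n))) (subst (p ℕ.<_) e (ℕP.m<m+n p (s≤s z≤n)))
  completePairs f {p} H e | yes (x , nz , xu , xw) = res f e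
    where
      open HyperbolicPairs H
      RO : IsotropicOver H (single x)
      RO = record { ru = λ _ → xu ; rw = λ _ → xw ; rr = λ _ _ → form-alternating x }
      open PairLemmas H
      open PairsAndRadical H (single x) RO
      pp = p ℕ.+ p
      b : Fin (pp ℕ.+ 1) → Carrier
      b = _++_ {m = pp} (λ _ → 0ᶠ) (λ _ → 1ᶠ)
      sol = form-solvable basis (basis-indep (single-indep x nz)) b
      y = proj₁ sol
      yu : ∀ a → form (u a) y ≡ 0ᶠ
      yu a = trans (cong (λ t → form t y) (sym (trans (lookup-++ˡ G (single x) (a ↑ˡ p)) (lookup-++ˡ u w a)))) (trans (proj₂ sol ((a ↑ˡ p) ↑ˡ 1)) (lookup-++ˡ {m = pp} _ _ (a ↑ˡ p)))
      yw : ∀ a → form (w a) y ≡ 0ᶠ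
      yw a = trans (cong (λ t → form t y) (sym (trans (lookup-++ˡ G (single x) (p ↑ʳ a)) (lookup-++ʳ u w a)))) (trans (proj₂ sol ((p ↑ʳ a) ↑ˡ 1)) (lookup-++ˡ {m = pp} _ _ (p ↑ʳ a)))
      xy : form x y ≡ 1ᶠ
      xy = trans (cong (λ t → form t y) (sym (lookup-++ʳ G (single x) Fin.zero))) (trans (proj₂ sol (pp ↑ʳ Fin.zero)) (lookup-++ʳ {m = pp} (λ _ → 0ᶠ) (λ _ → 1ᶠ) Fin.zero))
      H1 = extendPairs H x y xu xw (λ a → form-⊥-sym (u a) y (yu a)) (λ a → form-⊥-sym (w a) y (yw a)) xy
      res : ∀ f → p ℕ.+ f ≡ ν → Completion H
      res zero e = ⊥-elim (ℕP.1+n≰n (subst (suc p ≤_) (sym (trans (sym (ℕP.+-identityʳ p)) e)) (pairs-bound H1)))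
      res (suc f') e = record { p' = Completion.p' rec ; H' = Completion.H' rec ; eq = Completion.eq rec
        ; pres-u = λ i a ea → trans (Completion.pres-u rec i (inject₁ a) (trans ea (sym (FinP.toℕ-inject₁ a)))) (snoc-inj u x a)
        ; pres-w = λ i a ea → trans (Completion.pres-w rec i (inject₁ a) (trans ea (sym (FinP.toℕ-inject₁ a)))) (snoc-inj w y a) }
        where rec = completePairs f' H1 (trans (sym (ℕP.+-suc p f')) e)

  record SymplecticBasis {p k} (H : HyperbolicPairs p) (Rd : Mat k N) : Set where
    field
      B : Mat N N
      Bsymp : IsSymplectic B
      B-u : ∀ (i : Fin ν) (a : Fin p) → toℕ i ≡ toℕ a → B (i ↑ˡ ν) ≡ HyperbolicPairs.u H a
      B-w : ∀ (i : Fin ν) (a : Fin p) → toℕ i ≡ toℕ a → B (ν ↑ʳ i) ≡ HyperbolicPairs.w H a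
      B-r : ∀ (i : Fin ν) (c : Fin k) → toℕ i ≡ p ℕ.+ toℕ c → B (i ↑ˡ ν) ≡ Rd c
      bound : p ℕ.+ k ≤ ν

  pairs-symplectic : (H : HyperbolicPairs ν) → IsSymplectic (PairLemmas.G H)
  pairs-symplectic H = ++-elim (λ z → ∀ j → form (G z) (G j) ≡ K z j)
    (λ a → ++-elim (λ j → form (G (a ↑ˡ ν)) (G j) ≡ K (a ↑ˡ ν) j)
       (λ b → trans (cong₂ form (lookup-++ˡ u w a) (lookup-++ˡ u w b)) (trans (uu a b) (sym (K-ll a b))))
       (λ b → trans (cong₂ form (lookup-++ˡ u w a) (lookup-++ʳ u w b)) (trans (uw a b) (sym (K-lr a b)))))
    (λ a → ++-elim (λ j → form (G (ν ↑ʳ a)) (G j) ≡ K (ν ↑ʳ a) j)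
       (λ b → trans (cong₂ form (lookup-++ʳ u w a) (lookup-++ˡ u w b)) (trans (wu a b) (trans (cong -ᶠ_ (δ-sym b a)) (sym (K-rl a b)))))
       (λ b → trans (cong₂ form (lookup-++ʳ u w a) (lookup-++ʳ u w b)) (trans (ww a b) (sym (K-rr a b)))))
    where
      open HyperbolicPairs H
      open PairLemmas H

  resize : ∀ {p''} (H'' : HyperbolicPairs p'') → p'' ≡ ν → Σ (HyperbolicPairs ν) λ Hν →
    (∀ (i : Fin ν) (j : Fin p'') → toℕ i ≡ toℕ j → (HyperbolicPairs.u Hν i ≡ HyperbolicPairs.u H'' j) × (HyperbolicPairs.w Hν i ≡ HyperbolicPairs.w H'' j))
  resize H'' refl = H'' , λ i j e → cong (HyperbolicPairs.u H'') (FinP.toℕ-injective e) , cong (HyperbolicPairs.w H'') (FinP.toℕ-injective e)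

  symplecticBasis : ∀ {p k} (H : HyperbolicPairs p) (Rd : Mat k N) → IsotropicOver H Rd → LinIndepRows Rd → SymplecticBasis H Rd
  symplecticBasis {p} {k} H Rd RO ind = record
    { B = B ; Bsymp = pairs-symplectic Hν ; B-u = B-u ; B-w = B-w ; B-r = B-r
    ; bound = subst (_≤ ν) (PairedRadical.eq r) (pairs-bound H′) }
    where
      open HyperbolicPairs using (u; w)
      r = pairRadical k H Rd RO ind
      H′ = PairedRadical.H' r
      fp = completePairs (ν ℕ.∸ PairedRadical.p' r) H′ (ℕP.m+[n∸m]≡n (pairs-bound H′))
      T = resize (Completion.H' fp) (Completion.eq fp)
      Hν = proj₁ T
      B = PairLemmas.G Hν

      Hν≈H′ : ∀ (i : Fin ν) j → toℕ i ≡ toℕ j → (u Hν i ≡ u H′ j) × (w Hν i ≡ w H′ j)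
      Hν≈H′ i j e = trans (proj₁ Hν≈H″) (Completion.pres-u fp i″ j i″≡j) , trans (proj₂ Hν≈H″) (Completion.pres-w fp i″ j i″≡j)
        where
          i<p″ = subst (toℕ i ℕ.<_) (sym (Completion.eq fp)) (FinP.toℕ<n i)
          i″ = Fin.fromℕ< i<p″
          i″≡j = trans (FinP.toℕ-fromℕ< i<p″) e
          Hν≈H″ = proj₂ T i i″ (sym (FinP.toℕ-fromℕ< i<p″))

      at : ∀ {t} → t ℕ.< p ℕ.+ k → Fin (PairedRadical.p' r)
      at t<p+k = Fin.fromℕ< (subst (_ ℕ.<_) (sym (PairedRadical.eq r)) t<p+k)

      toℕ-at : ∀ {t} (t<p+k : t ℕ.< p ℕ.+ k) → toℕ (at t<p+k) ≡ t
      toℕ-at t<p+k = FinP.toℕ-fromℕ< _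

      pair< : (a : Fin p) → toℕ a ℕ.< p ℕ.+ k
      pair< a = ℕP.<-≤-trans (FinP.toℕ<n a) (ℕP.m≤m+n p k)

      B-u : ∀ (i : Fin ν) (a : Fin p) → toℕ i ≡ toℕ a → B (i ↑ˡ ν) ≡ u H a
      B-u i a e = trans (lookup-++ˡ (u Hν) (w Hν) i)
        (trans (proj₁ (Hν≈H′ i _ (trans e (sym (toℕ-at (pair< a)))))) (PairedRadical.pres-u r _ a (toℕ-at (pair< a))))

      B-w : ∀ (i : Fin ν) (a : Fin p) → toℕ i ≡ toℕ a → B (ν ↑ʳ i) ≡ w H a
      B-w i a e = trans (lookup-++ʳ (u Hν) (w Hν) i)
        (trans (proj₂ (Hν≈H′ i _ (trans e (sym (toℕ-at (pair< a)))))) (PairedRadical.pres-w r _ a (toℕ-at (pair< a))))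

      B-r : ∀ (i : Fin ν) (c : Fin k) → toℕ i ≡ p ℕ.+ toℕ c → B (i ↑ˡ ν) ≡ Rd c
      B-r i c e = trans (lookup-++ˡ (u Hν) (w Hν) i)
        (trans (proj₁ (Hν≈H′ i _ (trans e (sym (toℕ-at rad<))))) (PairedRadical.rad-u r _ c (toℕ-at rad<)))
        where rad< = ℕP.+-monoʳ-< p (FinP.toℕ<n c)

  -- A maximal family of hyperbolic pairs in a subspace, and its radical

  span-perpˡ : ∀ {m} (A : Mat m N) v t → InRowSpace v A → (∀ i → form (A i) t ≡ 0ᶠ) → form v t ≡ 0ᶠ
  span-perpˡ {m} A v t (c , p) h = trans (form-ext p (λ _ → refl)) (trans (form-lcˡ c A t) (∑-zero {m} (λ i → zeroʳ-≡ _ _ (h i))))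

  span-perpʳ : ∀ {m} (A : Mat m N) v t → InRowSpace t A → (∀ i → form v (A i) ≡ 0ᶠ) → form v t ≡ 0ᶠ
  span-perpʳ {m} A v t (c , p) h = trans (form-ext (λ _ → refl) p) (trans (form-lcʳ c A v) (∑-zero {m} (λ i → zeroˡ-≡ _ _ (h i))))

  PerpToPairs : ∀ {p} → HyperbolicPairs p → V N → Set
  PerpToPairs H x = (∀ a → form x (HyperbolicPairs.u H a) ≡ 0ᶠ) × (∀ a → form x (HyperbolicPairs.w H a) ≡ 0ᶠ)

  perpToPairs? : ∀ {p} (H : HyperbolicPairs p) x → Dec (PerpToPairs H x)
  perpToPairs? H x = FinP.all? (λ a → form x (HyperbolicPairs.u H a) ≟ᶠ 0ᶠ) ×-dec FinP.all? (λ a → form x (HyperbolicPairs.w H a) ≟ᶠ 0ᶠ)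

  perpToPairs-resp : ∀ {p} (H : HyperbolicPairs p) x x' → (∀ j → x j ≡ x' j) → PerpToPairs H x → PerpToPairs H x'
  perpToPairs-resp H x x' e (pu , pw) = (λ a → trans (form-ext (λ j → sym (e j)) (λ _ → refl)) (pu a)) , (λ a → trans (form-ext (λ j → sym (e j)) (λ _ → refl)) (pw a))

  record MaximalPairs {m} (A : Mat m N) : Set where
    field
      p : ℕ
      H : HyperbolicPairs p
      u-in : ∀ a → InRowSpace (HyperbolicPairs.u H a) A
      w-in : ∀ a → InRowSpace (HyperbolicPairs.w H a) A
      iso : ∀ x y → InRowSpace x A → InRowSpace y A → PerpToPairs H x → PerpToPairs H y → form x y ≡ 0ᶠ

  NewPair : ∀ {m p} (A : Mat m N) (H : HyperbolicPairs p) → V N → V N → Set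
  NewPair A H x y = InRowSpace x A × (InRowSpace y A × (PerpToPairs H x × (PerpToPairs H y × (form x y ≡ 1ᶠ))))

  newPair? : ∀ {m p} (A : Mat m N) (H : HyperbolicPairs p) → Dec (Σ (V N) λ x → Σ (V N) λ y → NewPair A H x y)
  newPair? A H = any-vector? N (λ x → Σ (V N) λ y → NewPair A H x y)
    (λ x x' e (y , ix , iy , px , py , xy) → y , span-ext A e ix , iy , perpToPairs-resp H x x' e px , py , trans (form-ext (λ j → sym (e j)) (λ _ → refl)) xy)
    (λ x → any-vector? N (λ y → NewPair A H x y)
      (λ y y' e (ix , iy , px , py , xy) → ix , span-ext A e iy , px , perpToPairs-resp H y y' e py , trans (form-ext (λ _ → refl) (λ j → sym (e j))) xy)
      (λ y → span? x A ×-dec span? y A ×-dec perpToPairs? H x ×-dec perpToPairs? H y ×-dec form x y ≟ᶠ 1ᶠ))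

  -- Pairs are added while some x, y in A orthogonal to the current pairs have form x y ≠ 0
  -- (rescaling y to form x y = 1); at most ν pairs fit, which bounds the recursion.
  maximalPairs-fuel : ∀ {m} (A : Mat m N) f {p} (H : HyperbolicPairs p) →
    (∀ a → InRowSpace (HyperbolicPairs.u H a) A) → (∀ a → InRowSpace (HyperbolicPairs.w H a) A) → p ℕ.+ f ≡ ν → MaximalPairs A
  maximalPairs-fuel A f {p} H uin win e with newPair? A H
  ... | no np = record { p = p ; H = H ; u-in = uin ; w-in = win ; iso = iso }
    where
      iso : ∀ x y → InRowSpace x A → InRowSpace y A → PerpToPairs H x → PerpToPairs H y → form x y ≡ 0ᶠ
      iso x y ix iy px py with form x y ≟ᶠ 0ᶠ
      ... | yes z = z
      ... | no nz = ⊥-elim (np (x , y' , ix , span-* (inv _ nz) A iy , px ,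
              ((λ a → trans (form-*ˡ (inv _ nz) y (HyperbolicPairs.u H a)) (zeroʳ-≡ _ _ (proj₁ py a))) ,
               (λ a → trans (form-*ˡ (inv _ nz) y (HyperbolicPairs.w H a)) (zeroʳ-≡ _ _ (proj₂ py a)))) ,
              trans (form-*ʳ (inv _ nz) y x) (trans (*-comm _ _) (inv-r _ nz))))
        where y' = λ j → inv (form x y) nz *ᶠ y j
  ... | yes (x , y , ix , iy , px , py , xy) = res f e
    where
      H1 = extendPairs H x y (proj₁ px) (proj₂ px) (proj₁ py) (proj₂ py) xy
      res : ∀ f → p ℕ.+ f ≡ ν → MaximalPairs A
      res zero e = ⊥-elim (ℕP.1+n≰n (subst (suc p ≤_) (sym (trans (sym (ℕP.+-identityʳ p)) e)) (pairs-bound H1)))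
      res (suc f') e = maximalPairs-fuel A f' H1
        (snoc-elim _ (λ a → subst (λ t → InRowSpace t A) (sym (snoc-inj (HyperbolicPairs.u H) x a)) (uin a)) (subst (λ t → InRowSpace t A) (sym (snoc-last (HyperbolicPairs.u H) x)) ix))
        (snoc-elim _ (λ a → subst (λ t → InRowSpace t A) (sym (snoc-inj (HyperbolicPairs.w H) y a)) (win a)) (subst (λ t → InRowSpace t A) (sym (snoc-last (HyperbolicPairs.w H) y)) iy))
        (trans (sym (ℕP.+-suc p f')) e)

  noPairs : HyperbolicPairs 0
  noPairs = record { u = λ () ; w = λ () ; uu = λ () ; ww = λ () ; uw = λ () }

  maximalPairs : ∀ {m} (A : Mat m N) → MaximalPairs A
  maximalPairs A = maximalPairs-fuel A ν noPairs (λ ()) (λ ()) refl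

  module PairsAndRadicalSpan {m r} (A : Mat m N) (SBr : MaximalPairs A) (Rr : Mat r N)
    (Rin : ∀ c → InRowSpace (Rr c) A) (Rsp : ∀ v → InRowSpace v A → (∀ i → form v (A i) ≡ 0ᶠ) → InRowSpace v Rr)
    (RO : IsotropicOver (MaximalPairs.H SBr) Rr) where
    H = MaximalPairs.H SBr
    open HyperbolicPairs H
    open PairLemmas H
    open PairsAndRadical H Rr RO
    open Projection H

    G-in : ∀ z → InRowSpace (G z) A
    G-in = ++-elim _ (λ a → subst (λ t → InRowSpace t A) (sym (lookup-++ˡ u w a)) (MaximalPairs.u-in SBr a))
                     (λ a → subst (λ t → InRowSpace t A) (sym (lookup-++ʳ u w a)) (MaximalPairs.w-in SBr a))

    basis-in : ∀ x → InRowSpace (basis x) A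
    basis-in = ++-elim _ (λ z → subst (λ t → InRowSpace t A) (sym (lookup-++ˡ G Rr z)) (G-in z))
                      (λ c → subst (λ t → InRowSpace t A) (sym (lookup-++ʳ G Rr c)) (Rin c))

    perp-in : ∀ v → InRowSpace v A → InRowSpace (perp v) A
    perp-in v iv = span-+ A iv (span-neg A (span-lc (coords v) G A G-in))

    perpG : ∀ v z → form (perp v) (G z) ≡ 0ᶠ
    perpG v = ++-elim _ (λ a → trans (cong (form (perp v)) (lookup-++ˡ u w a)) (perp-u v a))
                        (λ a → trans (cong (form (perp v)) (lookup-++ʳ u w a)) (perp-w v a))

    -- perp v is orthogonal to the pairs, so by maximality of the pairs it is orthogonal to all of A.
    perp-rad : ∀ v → InRowSpace v A → ∀ t → InRowSpace t A → form (perp v) t ≡ 0ᶠ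
    perp-rad v iv t it = begin
      form (perp v) t ≡⟨ form-ext (λ _ → refl) (perp-decomp t) ⟩
      form (perp v) (λ j → perp t j +ᶠ lc (coords t) G j) ≡⟨ form-+ʳ (perp t) (lc (coords t) G) (perp v) ⟩
      form (perp v) (perp t) +ᶠ form (perp v) (lc (coords t) G)
        ≡⟨ cong₂ _+ᶠ_ (MaximalPairs.iso SBr (perp v) (perp t) (perp-in v iv) (perp-in t it) (perp-u v , perp-w v) (perp-u t , perp-w t))
                      (span-perpʳ G (perp v) (lc (coords t) G) (coords t , λ j → refl) (perpG v)) ⟩
      0ᶠ +ᶠ 0ᶠ ≡⟨ +-identityˡ _ ⟩
      0ᶠ ∎
      where open ≡-Reasoning

    A-in : ∀ v → InRowSpace v A → InRowSpace v basis
    A-in v iv = span-ext basis (λ j → trans (+-comm _ _) (sym (perp-decomp v j)))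
      (span-++ G Rr (coords v , λ j → refl) (Rsp (perp v) (perp-in v iv) (λ i → perp-rad v iv (A i) (span-row A i))))

    basis-spans : SameRowSpace basis A
    basis-spans = basis-in , (λ i → A-in (A i) (span-row A i))

  -- A symplectic basis adapted to an edge

  sumMat≐++ : (X Y : Vertex) → sumMat X Y ≐ (mat X ++ mat Y)
  sumMat≐++ X Y i j with splitAt (dim X) i
  ... | inj₁ a = refl
  ... | inj₂ b = refl

  module EdgeBasis (ed : Edge) where
    X1 = end₁ ed
    X2 = end₂ ed
    A1 = mat X1
    A2 = mat X2
    inX1 : V N → Set
    inX1 v = InRowSpace v A1
    inX2 : V N → Set
    inX2 v = InRowSpace v A2

    orth12 : ∀ v t → inX1 v → inX2 t → form v t ≡ 0ᶠ
    orth12 v t iv it = span-perpˡ A1 v t iv (λ i → span-perpʳ A2 (A1 i) t it (λ j → Edge.orth ed i j))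
    orth21 : ∀ v t → inX2 v → inX1 t → form v t ≡ 0ᶠ
    orth21 v t iv it = form-⊥-sym t v (orth12 t v it iv)

    InX₁∩X₂ : V N → Set
    InX₁∩X₂ v = inX1 v × inX2 v
    InRadX₁ : V N → Set
    InRadX₁ v = inX1 v × (∀ i → form v (A1 i) ≡ 0ᶠ)
    InRadX₂ : V N → Set
    InRadX₂ v = inX2 v × (∀ i → form v (A2 i) ≡ 0ᶠ)

    InX₁∩X₂? : ∀ v → Dec (InX₁∩X₂ v)
    InX₁∩X₂? v = span? v A1 ×-dec span? v A2
    InRadX₁? : ∀ v → Dec (InRadX₁ v)
    InRadX₁? v = span? v A1 ×-dec FinP.all? (λ i → form v (A1 i) ≟ᶠ 0ᶠ)
    InRadX₂? : ∀ v → Dec (InRadX₂ v)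
    InRadX₂? v = span? v A2 ×-dec FinP.all? (λ i → form v (A2 i) ≟ᶠ 0ᶠ)
    InX₁∩X₂-resp : Respects≗ InX₁∩X₂
    InX₁∩X₂-resp v w e (a , b) = span-ext A1 e a , span-ext A2 e b
    InRadX₁-resp : Respects≗ InRadX₁
    InRadX₁-resp v w e (a , b) = span-ext A1 e a , λ i → trans (form-ext (λ j → sym (e j)) (λ _ → refl)) (b i)
    InRadX₂-resp : Respects≗ InRadX₂
    InRadX₂-resp v w e (a , b) = span-ext A2 e a , λ i → trans (form-ext (λ j → sym (e j)) (λ _ → refl)) (b i)

    OrthToBoth : V N → Set
    OrthToBoth v = (∀ t → inX1 t → form v t ≡ 0ᶠ) × (∀ t → inX2 t → form v t ≡ 0ᶠ)

    RadX₁⇒OrthToBoth : ∀ v → InRadX₁ v → OrthToBoth v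
    RadX₁⇒OrthToBoth v (iv , pv) = (λ t it → span-perpʳ A1 v t it pv) , (λ t it → orth12 v t iv it)
    RadX₂⇒OrthToBoth : ∀ v → InRadX₂ v → OrthToBoth v
    RadX₂⇒OrthToBoth v (iv , pv) = (λ t it → orth21 v t iv it) , (λ t it → span-perpʳ A2 v t it pv)
    ∩⇒RadX₁ : ∀ v → InX₁∩X₂ v → InRadX₁ v
    ∩⇒RadX₁ v (i1 , i2) = i1 , λ i → orth21 v (A1 i) i2 (span-row A1 i)
    ∩⇒RadX₂ : ∀ v → InX₁∩X₂ v → InRadX₂ v
    ∩⇒RadX₂ v (i1 , i2) = i2 , λ i → orth12 v (A2 i) i1 (span-row A2 i)

    ∅ : Mat 0 N
    ∅ ()

    XI = extend InX₁∩X₂ InX₁∩X₂? InX₁∩X₂-resp ∅ (λ c h ())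
    eI = Extension.size XI
    EI = Extension.rows XI
    BI : Mat (eI ℕ.+ 0) N
    BI = EI ++ ∅
    BI-in : ∀ c → InX₁∩X₂ (BI c)
    BI-in = ++-elim (λ c → InX₁∩X₂ (BI c)) (λ a → subst InX₁∩X₂ (sym (lookup-++ˡ EI ∅ a)) (Extension.rows∈S XI a)) (λ ())
    BI-ind : LinIndepRows BI
    BI-ind = Extension.indep XI

    X1E = extend InRadX₁ InRadX₁? InRadX₁-resp BI BI-ind
    e1 = Extension.size X1E
    E1 = Extension.rows X1E
    R1 : Mat (e1 ℕ.+ (eI ℕ.+ 0)) N
    R1 = E1 ++ BI
    R1-in : ∀ c → InRadX₁ (R1 c)
    R1-in = ++-elim (λ c → InRadX₁ (R1 c)) (λ a → subst InRadX₁ (sym (lookup-++ˡ E1 BI a)) (Extension.rows∈S X1E a))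
                                       (λ a → subst InRadX₁ (sym (lookup-++ʳ E1 BI a)) (∩⇒RadX₁ _ (BI-in a)))
    X2E = extend InRadX₂ InRadX₂? InRadX₂-resp BI BI-ind
    e2 = Extension.size X2E
    E2 = Extension.rows X2E
    R2 : Mat (e2 ℕ.+ (eI ℕ.+ 0)) N
    R2 = E2 ++ BI
    R2-in : ∀ c → InRadX₂ (R2 c)
    R2-in = ++-elim (λ c → InRadX₂ (R2 c)) (λ a → subst InRadX₂ (sym (lookup-++ˡ E2 BI a)) (Extension.rows∈S X2E a))
                                       (λ a → subst InRadX₂ (sym (lookup-++ʳ E2 BI a)) (∩⇒RadX₂ _ (BI-in a)))
    RW : Mat (e2 ℕ.+ (e1 ℕ.+ (eI ℕ.+ 0))) N
    RW = E2 ++ R1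

    InEither : V N → Set
    InEither v = inX1 v ⊎ inX2 v

    RW-info : ∀ c → OrthToBoth (RW c) × InEither (RW c)
    RW-info = ++-elim (λ c → OrthToBoth (RW c) × InEither (RW c))
      (λ a → subst (λ t → OrthToBoth t × InEither t) (sym (lookup-++ˡ E2 R1 a)) (RadX₂⇒OrthToBoth _ (Extension.rows∈S X2E a) , inj₂ (proj₁ (Extension.rows∈S X2E a))))
      (λ a → subst (λ t → OrthToBoth t × InEither t) (sym (lookup-++ʳ E2 R1 a)) (RadX₁⇒OrthToBoth _ (R1-in a) , inj₁ (proj₁ (R1-in a))))

    -- A relation Σ c₂ E₂ = - Σ c' R₁ gives a vector of X₂ ∩ X₁, hence in the span of BI; independence
    -- of E₂ ++ BI then kills c₂, and independence of R₁ kills c'.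
    RW-ind : LinIndepRows RW
    RW-ind c h = ++-elim (λ z → c z ≡ 0ᶠ) c2-0 c'-0
      where
        r = e1 ℕ.+ (eI ℕ.+ 0)
        c2 : Fin e2 → Carrier
        c2 i = c (i ↑ˡ r)
        c' : Fin r → Carrier
        c' i = c (e2 ↑ʳ i)
        sum0 : ∀ j → lc c2 E2 j +ᶠ lc c' R1 j ≡ 0ᶠ
        sum0 j = trans (sym (lc-++ c E2 R1 j)) (h j)
        wv = lc c2 E2
        w-in2 : inX2 wv
        w-in2 = span-lc c2 E2 A2 (λ i → proj₁ (Extension.rows∈S X2E i))
        w-eq : ∀ j → -ᶠ lc c' R1 j ≡ wv j
        w-eq j = sym (+-inverseʳ-unique _ _ (trans (+-comm _ _) (sum0 j)))
        w-in1 : inX1 wv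
        w-in1 = span-ext A1 w-eq (span-neg A1 (span-lc c' R1 A1 (λ i → proj₁ (R1-in i))))
        wBI : InRowSpace wv BI
        wBI = Extension.spans-S XI wv (w-in1 , w-in2)
        d = proj₁ wBI
        cc = _++_ {m = e2} c2 (λ i → -ᶠ d i)
        cc0 : ∀ z → cc z ≡ 0ᶠ
        cc0 = Extension.indep X2E cc (λ j → trans (lc-++-++ c2 (λ i → -ᶠ d i) E2 BI j)
                (trans (cong (wv j +ᶠ_) (lc-neg d BI j)) (trans (cong (λ t → wv j +ᶠ -ᶠ t) (sym (proj₂ wBI j))) (-‿inverseʳ _))))
        c2-0 : ∀ i → c (i ↑ˡ r) ≡ 0ᶠ
        c2-0 i = trans (sym (lookup-++ˡ c2 (λ i → -ᶠ d i) i)) (cc0 (i ↑ˡ (eI ℕ.+ 0)))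
        c'-0 : ∀ i → c (e2 ↑ʳ i) ≡ 0ᶠ
        c'-0 = Extension.indep X1E c' (λ j → trans (sym (+-identityˡ _)) (trans (cong (_+ᶠ lc c' R1 j) (sym (∑-zero {e2} (λ i → zeroˡ-≡ _ _ (c2-0 i))))) (sum0 j)))

    maxPairs₁ = maximalPairs A1
    maxPairs₂ = maximalPairs A2
    s1 = MaximalPairs.p maxPairs₁
    s2 = MaximalPairs.p maxPairs₂
    H1 = MaximalPairs.H maxPairs₁
    H2 = MaximalPairs.H maxPairs₂
    u1 = HyperbolicPairs.u H1
    w1 = HyperbolicPairs.w H1
    u2 = HyperbolicPairs.u H2
    w2 = HyperbolicPairs.w H2

    H12 : HyperbolicPairs (s1 ℕ.+ s2)
    H12 = record { u = u1 ++ u2 ; w = w1 ++ w2 ; uu = uu ; ww = ww ; uw = uw }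
      where
        uu : ∀ a b → form ((u1 ++ u2) a) ((u1 ++ u2) b) ≡ 0ᶠ
        uu = ++-elim₂ _ (λ x y → trans (cong₂ form (lookup-++ˡ u1 u2 x) (lookup-++ˡ u1 u2 y)) (HyperbolicPairs.uu H1 x y))
                     (λ x y → trans (cong₂ form (lookup-++ˡ u1 u2 x) (lookup-++ʳ u1 u2 y)) (orth12 _ _ (MaximalPairs.u-in maxPairs₁ x) (MaximalPairs.u-in maxPairs₂ y)))
                     (λ x y → trans (cong₂ form (lookup-++ʳ u1 u2 x) (lookup-++ˡ u1 u2 y)) (orth21 _ _ (MaximalPairs.u-in maxPairs₂ x) (MaximalPairs.u-in maxPairs₁ y)))
                     (λ x y → trans (cong₂ form (lookup-++ʳ u1 u2 x) (lookup-++ʳ u1 u2 y)) (HyperbolicPairs.uu H2 x y))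
        ww : ∀ a b → form ((w1 ++ w2) a) ((w1 ++ w2) b) ≡ 0ᶠ
        ww = ++-elim₂ _ (λ x y → trans (cong₂ form (lookup-++ˡ w1 w2 x) (lookup-++ˡ w1 w2 y)) (HyperbolicPairs.ww H1 x y))
                     (λ x y → trans (cong₂ form (lookup-++ˡ w1 w2 x) (lookup-++ʳ w1 w2 y)) (orth12 _ _ (MaximalPairs.w-in maxPairs₁ x) (MaximalPairs.w-in maxPairs₂ y)))
                     (λ x y → trans (cong₂ form (lookup-++ʳ w1 w2 x) (lookup-++ˡ w1 w2 y)) (orth21 _ _ (MaximalPairs.w-in maxPairs₂ x) (MaximalPairs.w-in maxPairs₁ y)))
                     (λ x y → trans (cong₂ form (lookup-++ʳ w1 w2 x) (lookup-++ʳ w1 w2 y)) (HyperbolicPairs.ww H2 x y))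
        uw : ∀ a b → form ((u1 ++ u2) a) ((w1 ++ w2) b) ≡ δ a b
        uw = ++-elim₂ _ (λ x y → trans (cong₂ form (lookup-++ˡ u1 u2 x) (lookup-++ˡ w1 w2 y)) 
                             (trans (HyperbolicPairs.uw H1 x y) (sym (δ-injective (_↑ˡ s2) (λ {a} {b} → FinP.↑ˡ-injective s2 a b) x y))))
                     (λ x y → trans (cong₂ form (lookup-++ˡ u1 u2 x) (lookup-++ʳ w1 w2 y)) (trans (orth12 _ _ (MaximalPairs.u-in maxPairs₁ x) (MaximalPairs.w-in maxPairs₂ y)) (sym (δ-lr x y))))
                     (λ x y → trans (cong₂ form (lookup-++ʳ u1 u2 x) (lookup-++ˡ w1 w2 y)) (trans (orth21 _ _ (MaximalPairs.u-in maxPairs₂ x) (MaximalPairs.w-in maxPairs₁ y)) (sym (δ-rl y x))))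
                     (λ x y → trans (cong₂ form (lookup-++ʳ u1 u2 x) (lookup-++ʳ w1 w2 y)) 
                             (trans (HyperbolicPairs.uw H2 x y) (sym (δ-injective (s1 ↑ʳ_) (λ {a} {b} → FinP.↑ʳ-injective s1 a b) x y))))

    H12-in : ∀ z → InEither (HyperbolicPairs.u H12 z) × InEither (HyperbolicPairs.w H12 z)
    H12-in = ++-elim _ (λ x → subst InEither (sym (lookup-++ˡ u1 u2 x)) (inj₁ (MaximalPairs.u-in maxPairs₁ x)) , subst InEither (sym (lookup-++ˡ w1 w2 x)) (inj₁ (MaximalPairs.w-in maxPairs₁ x)))
                       (λ x → subst InEither (sym (lookup-++ʳ u1 u2 x)) (inj₂ (MaximalPairs.u-in maxPairs₂ x)) , subst InEither (sym (lookup-++ʳ w1 w2 x)) (inj₂ (MaximalPairs.w-in maxPairs₂ x)))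

    OrthToBoth-⊥ : ∀ v t → OrthToBoth v → InEither t → form v t ≡ 0ᶠ
    OrthToBoth-⊥ v t (p1 , p2) (inj₁ it) = p1 t it
    OrthToBoth-⊥ v t (p1 , p2) (inj₂ it) = p2 t it

    RW-isotropic : IsotropicOver H12 RW
    RW-isotropic = record
      { ru = λ c b → OrthToBoth-⊥ _ _ (proj₁ (RW-info c)) (proj₁ (H12-in b))
      ; rw = λ c b → OrthToBoth-⊥ _ _ (proj₁ (RW-info c)) (proj₂ (H12-in b))
      ; rr = λ c c' → OrthToBoth-⊥ _ _ (proj₁ (RW-info c)) (proj₂ (RW-info c')) }

    R1-isotropic : IsotropicOver H1 R1
    R1-isotropic = record
      { ru = λ c b → proj₁ (RadX₁⇒OrthToBoth _ (R1-in c)) _ (MaximalPairs.u-in maxPairs₁ b)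
      ; rw = λ c b → proj₁ (RadX₁⇒OrthToBoth _ (R1-in c)) _ (MaximalPairs.w-in maxPairs₁ b)
      ; rr = λ c c' → proj₁ (RadX₁⇒OrthToBoth _ (R1-in c)) _ (proj₁ (R1-in c')) }

    R2-isotropic : IsotropicOver H2 R2
    R2-isotropic = record
      { ru = λ c b → proj₂ (RadX₂⇒OrthToBoth _ (R2-in c)) _ (MaximalPairs.u-in maxPairs₂ b)
      ; rw = λ c b → proj₂ (RadX₂⇒OrthToBoth _ (R2-in c)) _ (MaximalPairs.w-in maxPairs₂ b)
      ; rr = λ c c' → proj₂ (RadX₂⇒OrthToBoth _ (R2-in c)) _ (proj₁ (R2-in c')) }

    module S1 = PairsAndRadicalSpan A1 maxPairs₁ R1 (λ c → proj₁ (R1-in c)) (λ v iv pv → Extension.spans-S X1E v (iv , pv)) R1-isotropic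
    module S2 = PairsAndRadicalSpan A2 maxPairs₂ R2 (λ c → proj₁ (R2-in c)) (λ v iv pv → Extension.spans-S X2E v (iv , pv)) R2-isotropic
    module F1 = PairsAndRadical H1 R1 R1-isotropic
    module F2 = PairsAndRadical H2 R2 R2-isotropic
    module FW = PairsAndRadical H12 RW RW-isotropic
    fam1 = F1.basis
    fam2 = F2.basis
    famW = FW.basis
    G12 = PairLemmas.G H12
    u12 = HyperbolicPairs.u H12
    w12 = HyperbolicPairs.w H12
    rW = e2 ℕ.+ (e1 ℕ.+ (eI ℕ.+ 0))
    ppW = (s1 ℕ.+ s2) ℕ.+ (s1 ℕ.+ s2)

    either-span : ∀ v → InEither v → InRowSpace v (A1 ++ A2)
    either-span v (inj₁ iv) = span-++ˡ A1 A2 iv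
    either-span v (inj₂ iv) = span-++ʳ A1 A2 iv

    famW-in : ∀ x → InRowSpace (famW x) (A1 ++ A2)
    famW-in = ++-elim _
      (++-elim _ (λ z → subst (λ t → InRowSpace t (A1 ++ A2)) (sym (trans (lookup-++ˡ G12 RW (z ↑ˡ (s1 ℕ.+ s2))) (lookup-++ˡ u12 w12 z))) (either-span _ (proj₁ (H12-in z))))
                 (λ z → subst (λ t → InRowSpace t (A1 ++ A2)) (sym (trans (lookup-++ˡ G12 RW ((s1 ℕ.+ s2) ↑ʳ z)) (lookup-++ʳ u12 w12 z))) (either-span _ (proj₂ (H12-in z)))))
      (λ c → subst (λ t → InRowSpace t (A1 ++ A2)) (sym (lookup-++ʳ G12 RW c)) (either-span _ (proj₂ (RW-info c))))

    rowIn : ∀ {v} idx → famW idx ≡ v → InRowSpace v famW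
    rowIn idx e = subst (λ t → InRowSpace t famW) e (span-row famW idx)

    fam1-in : ∀ x → InRowSpace (fam1 x) famW
    fam1-in = ++-elim _
      (++-elim _ (λ a → subst (λ t → InRowSpace t famW) (sym (trans (lookup-++ˡ (PairLemmas.G H1) R1 (a ↑ˡ s1)) (lookup-++ˡ u1 w1 a)))
                          (rowIn (((a ↑ˡ s2) ↑ˡ (s1 ℕ.+ s2)) ↑ˡ rW) (trans (lookup-++ˡ G12 RW _) (trans (lookup-++ˡ u12 w12 _) (lookup-++ˡ u1 u2 a)))))
                 (λ a → subst (λ t → InRowSpace t famW) (sym (trans (lookup-++ˡ (PairLemmas.G H1) R1 (s1 ↑ʳ a)) (lookup-++ʳ u1 w1 a)))
                          (rowIn (((s1 ℕ.+ s2) ↑ʳ (a ↑ˡ s2)) ↑ˡ rW) (trans (lookup-++ˡ G12 RW _) (trans (lookup-++ʳ u12 w12 _) (lookup-++ˡ w1 w2 a))))))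
      (λ c → subst (λ t → InRowSpace t famW) (sym (lookup-++ʳ (PairLemmas.G H1) R1 c))
                 (rowIn (ppW ↑ʳ (e2 ↑ʳ c)) (trans (lookup-++ʳ G12 RW _) (lookup-++ʳ E2 R1 c))))

    fam2-in : ∀ x → InRowSpace (fam2 x) famW
    fam2-in = ++-elim _
      (++-elim _ (λ a → subst (λ t → InRowSpace t famW) (sym (trans (lookup-++ˡ (PairLemmas.G H2) R2 (a ↑ˡ s2)) (lookup-++ˡ u2 w2 a)))
                          (rowIn (((s1 ↑ʳ a) ↑ˡ (s1 ℕ.+ s2)) ↑ˡ rW) (trans (lookup-++ˡ G12 RW _) (trans (lookup-++ˡ u12 w12 _) (lookup-++ʳ u1 u2 a)))))
                 (λ a → subst (λ t → InRowSpace t famW) (sym (trans (lookup-++ˡ (PairLemmas.G H2) R2 (s2 ↑ʳ a)) (lookup-++ʳ u2 w2 a)))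
                          (rowIn (((s1 ℕ.+ s2) ↑ʳ (s1 ↑ʳ a)) ↑ˡ rW) (trans (lookup-++ˡ G12 RW _) (trans (lookup-++ʳ u12 w12 _) (lookup-++ʳ w1 w2 a))))))
      (λ c → subst (λ t → InRowSpace t famW) (sym (lookup-++ʳ (PairLemmas.G H2) R2 c))
         (++-elim (λ c → InRowSpace (R2 c) famW)
           (λ a → subst (λ t → InRowSpace t famW) (sym (lookup-++ˡ E2 BI a)) (rowIn (ppW ↑ʳ (a ↑ˡ _)) (trans (lookup-++ʳ G12 RW _) (lookup-++ˡ E2 R1 a))))
           (λ a → subst (λ t → InRowSpace t famW) (sym (lookup-++ʳ E2 BI a)) (rowIn (ppW ↑ʳ (e2 ↑ʳ (e1 ↑ʳ a))) (trans (lookup-++ʳ G12 RW _) (trans (lookup-++ʳ E2 R1 _) (lookup-++ʳ E1 BI a)))))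
           c))

    A12-in : ∀ i → InRowSpace ((A1 ++ A2) i) famW
    A12-in = ++-elim _ (λ a → subst (λ t → InRowSpace t famW) (sym (lookup-++ˡ A1 A2 a)) (span-trans fam1 famW (S1.A-in (A1 a) (span-row A1 a)) fam1-in))
                       (λ a → subst (λ t → InRowSpace t famW) (sym (lookup-++ʳ A1 A2 a)) (span-trans fam2 famW (S2.A-in (A2 a) (span-row A2 a)) fam2-in))

    srsW : SameRowSpace famW (sumMat X1 X2)
    srsW = SRS-trans (famW-in , A12-in) (SRS-ext (≐-sym (sumMat≐++ X1 X2)))

    ind1 : LinIndepRows fam1
    ind1 = F1.basis-indep (Extension.indep X1E)
    ind2 : LinIndepRows fam2
    ind2 = F2.basis-indep (Extension.indep X2E)
    indW : LinIndepRows famW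
    indW = FW.basis-indep RW-ind

    symplecticBasisW = symplecticBasis H12 RW RW-isotropic RW-ind

  record EdgeNumbers : Set where
    constructor nums
    field
      n-s1 n-s2 n-eI n-e1 n-e2 : ℕ

  module _ (n : EdgeNumbers) where
    open EdgeNumbers n
    d1 = (n-s1 ℕ.+ n-s1) ℕ.+ (n-e1 ℕ.+ (n-eI ℕ.+ 0))
    d2 = (n-s2 ℕ.+ n-s2) ℕ.+ (n-e2 ℕ.+ (n-eI ℕ.+ 0))
    dW = ((n-s1 ℕ.+ n-s2) ℕ.+ (n-s1 ℕ.+ n-s2)) ℕ.+ (n-e2 ℕ.+ (n-e1 ℕ.+ (n-eI ℕ.+ 0)))
    tot = (n-s1 ℕ.+ n-s2) ℕ.+ (n-e2 ℕ.+ (n-e1 ℕ.+ (n-eI ℕ.+ 0)))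

  -- Layout of an adapted basis: the pairs of X₁ occupy indices 0 … s₁ - 1 (u on the left half,
  -- w on the right half), those of X₂ the indices s₁ … s₁ + s₂ - 1, followed on the left half by
  -- the rows of E₂, E₁ and I.
  module Positions (n : EdgeNumbers) where
    open EdgeNumbers n
    S = n-s1 ℕ.+ n-s2
    lt-1 : tot n ≤ ν → ∀ (a : Fin n-s1) → toℕ a ℕ.< ν
    lt-1 bd a = ℕP.<-≤-trans (FinP.toℕ<n a) (ℕP.≤-trans (ℕP.m≤m+n n-s1 n-s2) (ℕP.≤-trans (ℕP.m≤m+n S _) bd))
    lt-2 : tot n ≤ ν → ∀ (a : Fin n-s2) → n-s1 ℕ.+ toℕ a ℕ.< ν
    lt-2 bd a = ℕP.<-≤-trans (ℕP.+-monoʳ-< n-s1 (FinP.toℕ<n a)) (ℕP.≤-trans (ℕP.m≤m+n S _) bd)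
    ltR : tot n ≤ ν → ∀ t → t ℕ.< n-e2 ℕ.+ (n-e1 ℕ.+ (n-eI ℕ.+ 0)) → S ℕ.+ t ℕ.< ν
    ltR bd t l = ℕP.<-≤-trans (ℕP.+-monoʳ-< S l) bd
    lt-E1 : tot n ≤ ν → ∀ (c : Fin n-e1) → S ℕ.+ (n-e2 ℕ.+ toℕ c) ℕ.< ν
    lt-E1 bd c = ltR bd _ (ℕP.+-monoʳ-< n-e2 (ℕP.<-≤-trans (FinP.toℕ<n c) (ℕP.m≤m+n n-e1 _)))
    lt-E2 : tot n ≤ ν → ∀ (c : Fin n-e2) → S ℕ.+ toℕ c ℕ.< ν
    lt-E2 bd c = ltR bd _ (ℕP.<-≤-trans (FinP.toℕ<n c) (ℕP.m≤m+n n-e2 _))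
    lt-I : tot n ≤ ν → ∀ (c : Fin (n-eI ℕ.+ 0)) → S ℕ.+ (n-e2 ℕ.+ (n-e1 ℕ.+ toℕ c)) ℕ.< ν
    lt-I bd c = ltR bd _ (ℕP.+-monoʳ-< n-e2 (ℕP.+-monoʳ-< n-e1 (FinP.toℕ<n c)))

    L : ∀ {t} → .(t ℕ.< ν) → Fin N
    L l = Fin.fromℕ< l ↑ˡ ν
    R : ∀ {t} → .(t ℕ.< ν) → Fin N
    R l = ν ↑ʳ Fin.fromℕ< l

    pI : .(tot n ≤ ν) → Fin (n-eI ℕ.+ 0) → Fin N
    pI bd c = L (lt-I bd c)

    module _ .(bd : tot n ≤ ν) where
      pairs₁ = (λ a → L (lt-1 bd a)) ++ (λ a → R (lt-1 bd a))
      rad₁ = (λ c → L (lt-E1 bd c)) ++ pI bd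
      pairs₂ = (λ a → L (lt-2 bd a)) ++ (λ a → R (lt-2 bd a))
      rad₂ = (λ c → L (lt-E2 bd c)) ++ pI bd

      pos1 : Fin (d1 n) → Fin N
      pos1 = pairs₁ ++ rad₁

      pos2 : Fin (d2 n) → Fin N
      pos2 = pairs₂ ++ rad₂

      pos1-u : ∀ a → pos1 ((a ↑ˡ n-s1) ↑ˡ (n-e1 ℕ.+ (n-eI ℕ.+ 0))) ≡ L (lt-1 bd a)
      pos1-u a = trans (lookup-++ˡ pairs₁ rad₁ (a ↑ˡ n-s1)) (lookup-++ˡ (λ a → L (lt-1 bd a)) (λ a → R (lt-1 bd a)) a)
      pos1-w : ∀ a → pos1 ((n-s1 ↑ʳ a) ↑ˡ (n-e1 ℕ.+ (n-eI ℕ.+ 0))) ≡ R (lt-1 bd a)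
      pos1-w a = trans (lookup-++ˡ pairs₁ rad₁ (n-s1 ↑ʳ a)) (lookup-++ʳ (λ a → L (lt-1 bd a)) (λ a → R (lt-1 bd a)) a)
      pos1-E : ∀ c → pos1 ((n-s1 ℕ.+ n-s1) ↑ʳ (c ↑ˡ (n-eI ℕ.+ 0))) ≡ L (lt-E1 bd c)
      pos1-E c = trans (lookup-++ʳ pairs₁ rad₁ (c ↑ˡ (n-eI ℕ.+ 0))) (lookup-++ˡ (λ c → L (lt-E1 bd c)) (pI bd) c)
      pos1-I : ∀ c → pos1 ((n-s1 ℕ.+ n-s1) ↑ʳ (n-e1 ↑ʳ c)) ≡ L (lt-I bd c)
      pos1-I c = trans (lookup-++ʳ pairs₁ rad₁ (n-e1 ↑ʳ c)) (lookup-++ʳ (λ c → L (lt-E1 bd c)) (pI bd) c)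
      pos2-u : ∀ a → pos2 ((a ↑ˡ n-s2) ↑ˡ (n-e2 ℕ.+ (n-eI ℕ.+ 0))) ≡ L (lt-2 bd a)
      pos2-u a = trans (lookup-++ˡ pairs₂ rad₂ (a ↑ˡ n-s2)) (lookup-++ˡ (λ a → L (lt-2 bd a)) (λ a → R (lt-2 bd a)) a)
      pos2-w : ∀ a → pos2 ((n-s2 ↑ʳ a) ↑ˡ (n-e2 ℕ.+ (n-eI ℕ.+ 0))) ≡ R (lt-2 bd a)
      pos2-w a = trans (lookup-++ˡ pairs₂ rad₂ (n-s2 ↑ʳ a)) (lookup-++ʳ (λ a → L (lt-2 bd a)) (λ a → R (lt-2 bd a)) a)
      pos2-E : ∀ c → pos2 ((n-s2 ℕ.+ n-s2) ↑ʳ (c ↑ˡ (n-eI ℕ.+ 0))) ≡ L (lt-E2 bd c)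
      pos2-E c = trans (lookup-++ʳ pairs₂ rad₂ (c ↑ˡ (n-eI ℕ.+ 0))) (lookup-++ˡ (λ c → L (lt-E2 bd c)) (pI bd) c)
      pos2-I : ∀ c → pos2 ((n-s2 ℕ.+ n-s2) ↑ʳ (n-e2 ↑ʳ c)) ≡ L (lt-I bd c)
      pos2-I c = trans (lookup-++ʳ pairs₂ rad₂ (n-e2 ↑ʳ c)) (lookup-++ʳ (λ c → L (lt-E2 bd c)) (pI bd) c)

  record AdaptedBasis (ed : Edge) (n : EdgeNumbers) : Set where
    open EdgeNumbers n
    field
      basis₁ : TypedBasis (mat (end₁ ed)) (d1 n) n-s1
      basis₂ : TypedBasis (mat (end₂ ed)) (d2 n) n-s2
      basis₁₂ : TypedBasis (sumMat (end₁ ed) (end₂ ed)) (dW n) (n-s1 ℕ.+ n-s2)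
      B : Mat N N
      Bsymp : IsSymplectic B
      bd : tot n ≤ ν
      rows₁-in-B : ∀ x → TypedBasis.rows basis₁ x ≡ B (Positions.pos1 n bd x)
      rows₂-in-B : ∀ x → TypedBasis.rows basis₂ x ≡ B (Positions.pos2 n bd x)

  module EdgeAdapted (ed : Edge) where
    open EdgeBasis ed
    nE : EdgeNumbers
    nE = nums s1 s2 eI e1 e2
    open Positions nE
    B = SymplecticBasis.B symplecticBasisW
    bd : tot nE ≤ ν
    bd = SymplecticBasis.bound symplecticBasisW
    G1 = PairLemmas.G H1
    G2 = PairLemmas.G H2

    fin : ∀ {d} (fam : Mat d N) (pos : Fin d → Fin N) x {v} j → fam x ≡ v → pos x ≡ j → B j ≡ v → fam x ≡ B (pos x)
    fin fam pos x j e1' e2' e3 = trans e1' (trans (sym e3) (cong B (sym e2')))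

    tL : ∀ {t} (l : t ℕ.< ν) → toℕ (Fin.fromℕ< l) ≡ t
    tL l = FinP.toℕ-fromℕ< l

    pos1-ok : ∀ x → fam1 x ≡ B (pos1 bd x)
    pos1-ok = ++-elim _
      (++-elim _
        (λ a → fin fam1 (pos1 bd) _ _ (trans (lookup-++ˡ G1 R1 _) (lookup-++ˡ u1 w1 a)) (pos1-u bd a)
                 (trans (SymplecticBasis.B-u symplecticBasisW _ (a ↑ˡ s2) (trans (tL (lt-1 bd a)) (sym (FinP.toℕ-↑ˡ a s2)))) (lookup-++ˡ u1 u2 a)))
        (λ a → fin fam1 (pos1 bd) _ _ (trans (lookup-++ˡ G1 R1 _) (lookup-++ʳ u1 w1 a)) (pos1-w bd a)
                 (trans (SymplecticBasis.B-w symplecticBasisW _ (a ↑ˡ s2) (trans (tL (lt-1 bd a)) (sym (FinP.toℕ-↑ˡ a s2)))) (lookup-++ˡ w1 w2 a))))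
      (++-elim _
        (λ c → fin fam1 (pos1 bd) _ _ (trans (lookup-++ʳ G1 R1 _) (lookup-++ˡ E1 BI c)) (pos1-E bd c)
                 (trans (SymplecticBasis.B-r symplecticBasisW _ (e2 ↑ʳ (c ↑ˡ (eI ℕ.+ 0))) (trans (tL (lt-E1 bd c)) (cong (s1 ℕ.+ s2 ℕ.+_) (trans (cong (e2 ℕ.+_) (sym (FinP.toℕ-↑ˡ c _))) (sym (FinP.toℕ-↑ʳ e2 _))))))
                        (trans (lookup-++ʳ E2 R1 _) (lookup-++ˡ E1 BI c))))
        (λ c → fin fam1 (pos1 bd) _ _ (trans (lookup-++ʳ G1 R1 _) (lookup-++ʳ E1 BI c)) (pos1-I bd c)
                 (trans (SymplecticBasis.B-r symplecticBasisW _ (e2 ↑ʳ (e1 ↑ʳ c)) (trans (tL (lt-I bd c)) (cong (s1 ℕ.+ s2 ℕ.+_) (trans (cong (e2 ℕ.+_) (sym (FinP.toℕ-↑ʳ e1 c))) (sym (FinP.toℕ-↑ʳ e2 _))))))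
                        (trans (lookup-++ʳ E2 R1 _) (lookup-++ʳ E1 BI c)))))

    pos2-ok : ∀ x → fam2 x ≡ B (pos2 bd x)
    pos2-ok = ++-elim _
      (++-elim _
        (λ a → fin fam2 (pos2 bd) _ _ (trans (lookup-++ˡ G2 R2 _) (lookup-++ˡ u2 w2 a)) (pos2-u bd a)
                 (trans (SymplecticBasis.B-u symplecticBasisW _ (s1 ↑ʳ a) (trans (tL (lt-2 bd a)) (sym (FinP.toℕ-↑ʳ s1 a)))) (lookup-++ʳ u1 u2 a)))
        (λ a → fin fam2 (pos2 bd) _ _ (trans (lookup-++ˡ G2 R2 _) (lookup-++ʳ u2 w2 a)) (pos2-w bd a)
                 (trans (SymplecticBasis.B-w symplecticBasisW _ (s1 ↑ʳ a) (trans (tL (lt-2 bd a)) (sym (FinP.toℕ-↑ʳ s1 a)))) (lookup-++ʳ w1 w2 a))))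
      (++-elim _
        (λ c → fin fam2 (pos2 bd) _ _ (trans (lookup-++ʳ G2 R2 _) (lookup-++ˡ E2 BI c)) (pos2-E bd c)
                 (trans (SymplecticBasis.B-r symplecticBasisW _ (c ↑ˡ (e1 ℕ.+ (eI ℕ.+ 0))) (trans (tL (lt-E2 bd c)) (cong (s1 ℕ.+ s2 ℕ.+_) (sym (FinP.toℕ-↑ˡ c _)))))
                        (lookup-++ˡ E2 R1 c)))
        (λ c → fin fam2 (pos2 bd) _ _ (trans (lookup-++ʳ G2 R2 _) (lookup-++ʳ E2 BI c)) (pos2-I bd c)
                 (trans (SymplecticBasis.B-r symplecticBasisW _ (e2 ↑ʳ (e1 ↑ʳ c)) (trans (tL (lt-I bd c)) (cong (s1 ℕ.+ s2 ℕ.+_) (trans (cong (e2 ℕ.+_) (sym (FinP.toℕ-↑ʳ e1 c))) (sym (FinP.toℕ-↑ʳ e2 _))))))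
                        (trans (lookup-++ʳ E2 R1 _) (lookup-++ʳ E1 BI c)))))

    adapted : AdaptedBasis ed nE
    adapted = record
      { basis₁ = record { rows = fam1 ; rows-indep = ind1 ; gram-rank = F1.gram-basis-rank ; spans = S1.basis-spans }
      ; basis₂ = record { rows = fam2 ; rows-indep = ind2 ; gram-rank = F2.gram-basis-rank ; spans = S2.basis-spans }
      ; basis₁₂ = record { rows = famW ; rows-indep = indW ; gram-rank = FW.gram-basis-rank ; spans = srsW }
      ; B = B ; Bsymp = SymplecticBasis.Bsymp symplecticBasisW ; bd = bd ; rows₁-in-B = pos1-ok ; rows₂-in-B = pos2-ok }

  -- Abstract so that the numbers of an edge, computed by exhaustive search, are never unfolded by
  -- the type checker.
  abstract
    adaptedBasis : (ed : Edge) → Σ EdgeNumbers (AdaptedBasis ed)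
    adaptedBasis ed = EdgeAdapted.nE ed , EdgeAdapted.adapted ed

  -- The two directions

  ++-· : ∀ {a b} (A : Mat a N) (B : Mat b N) (T : Mat N N) → ((A ++ B) · T) ≐ ((A · T) ++ (B · T))
  ++-· {a} A B T i j with splitAt a i
  ... | inj₁ x = refl
  ... | inj₂ y = refl

  SRS-++-++ : ∀ {a a' b b'} {A : Mat a N} {A' : Mat a' N} {B : Mat b N} {B' : Mat b' N} →
    SameRowSpace A A' → SameRowSpace B B' → SameRowSpace (A ++ B) (A' ++ B')
  SRS-++-++ {A = A} {A'} {B} {B'} (p , r) (p' , r') =
    ++-elim _ (λ x → subst (λ t → InRowSpace t (A' ++ B')) (sym (lookup-++ˡ A B x)) (span-++ˡ A' B' (p x)))
              (λ x → subst (λ t → InRowSpace t (A' ++ B')) (sym (lookup-++ʳ A B x)) (span-++ʳ A' B' (p' x))) ,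
    ++-elim _ (λ x → subst (λ t → InRowSpace t (A ++ B)) (sym (lookup-++ˡ A' B' x)) (span-++ˡ A B (r x)))
              (λ x → subst (λ t → InRowSpace t (A ++ B)) (sym (lookup-++ʳ A' B' x)) (span-++ʳ A B (r' x)))

  SRS-swap : ∀ {a b} (A : Mat a N) (B : Mat b N) → SameRowSpace (A ++ B) (B ++ A)
  SRS-swap A B =
    ++-elim _ (λ x → subst (λ t → InRowSpace t (B ++ A)) (sym (lookup-++ˡ A B x)) (span-++ʳ B A (span-row A x)))
              (λ x → subst (λ t → InRowSpace t (B ++ A)) (sym (lookup-++ʳ A B x)) (span-++ˡ B A (span-row B x))) ,
    ++-elim _ (λ x → subst (λ t → InRowSpace t (A ++ B)) (sym (lookup-++ˡ B A x)) (span-++ʳ A B (span-row B x)))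
              (λ x → subst (λ t → InRowSpace t (A ++ B)) (sym (lookup-++ʳ B A x)) (span-++ˡ A B (span-row A x)))

  sumMat-· : (X1 X2 Y1 Y2 : Vertex) (T : Mat N N) → SameRowSpace (mat X1 · T) (mat Y1) → SameRowSpace (mat X2 · T) (mat Y2) →
    SameRowSpace (sumMat X1 X2 · T) (sumMat Y1 Y2)
  sumMat-· X1 X2 Y1 Y2 T s1 s2 =
    SRS-trans (SRS-ext (≐-trans (·-congˡ T (sumMat≐++ X1 X2)) (++-· (mat X1) (mat X2) T)))
    (SRS-trans (SRS-++-++ s1 s2) (SRS-ext (≐-sym (sumMat≐++ Y1 Y2))))

  sumMat-comm : (Y₁ Y₂ : Vertex) → SameRowSpace (sumMat Y₂ Y₁) (sumMat Y₁ Y₂)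
  sumMat-comm Y₁ Y₂ = SRS-trans (SRS-ext (sumMat≐++ Y₂ Y₁)) (SRS-trans (SRS-swap (mat Y₂) (mat Y₁)) (SRS-ext (≐-sym (sumMat≐++ Y₁ Y₂))))

  sameOrbit⇒typeCondition : (e f : Edge) → SameOrbit e f → TypeCondition e f
  sameOrbit⇒typeCondition e f (T , symp , maps) = classify maps
    where
      open AdaptedBasis (proj₂ (adaptedBasis e))
      X₁ = end₁ e
      X₂ = end₂ e
      Y₁ = end₁ f
      Y₂ = end₂ f
      same : ∀ {m m′ d s} {P : Mat m N} {Q : Mat m′ N} → TypedBasis P d s → SameRowSpace (P · T) Q → SameType P Q
      same = sameType-· T symp
      classify : MapsTo T e f → TypeCondition e f
      classify (inj₁ (X₁T≈Y₁ , X₂T≈Y₂)) =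
        inj₁ (same basis₁ X₁T≈Y₁ , same basis₂ X₂T≈Y₂ , same basis₁₂ (sumMat-· X₁ X₂ Y₁ Y₂ T X₁T≈Y₁ X₂T≈Y₂))
      classify (inj₂ (X₁T≈Y₂ , X₂T≈Y₁)) =
        inj₂ (same basis₁ X₁T≈Y₂ , same basis₂ X₂T≈Y₁ , same basis₁₂ (SRS-trans (sumMat-· X₁ X₂ Y₂ Y₁ T X₁T≈Y₂ X₂T≈Y₁) (sumMat-comm Y₁ Y₂)))

  SymplecticTransport : Edge → Edge → Set
  SymplecticTransport e f =
    Σ (Mat N N) λ T → IsSymplectic T × SameRowSpace (mat (end₁ e) · T) (mat (end₁ f)) × SameRowSpace (mat (end₂ e) · T) (mat (end₂ f))

  -- With Bₑ and B_f adapted with the same numbers, T = Bₑ⁻¹ B_f sends every row Bₑ i to B_f i.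
  module _ (e f : Edge) (n : EdgeNumbers) (Ae : AdaptedBasis e n) (Af : AdaptedBasis f n) where
    private
      module E = AdaptedBasis Ae
      module Fa = AdaptedBasis Af
      Bₑ⁻¹ = symplectic-inverse E.B E.Bsymp
      R = SymplecticInverse.R Bₑ⁻¹
      T = R · Fa.B

      rows-· : ∀ {d} (fe ff : Mat d N) (pos : Fin d → Fin N) →
        (∀ x → fe x ≡ E.B (pos x)) → (∀ x → ff x ≡ Fa.B (pos x)) → (fe · T) ≐ ff
      rows-· fe ff pos fe-in-B ff-in-B x j = begin
        (fe · (R · Fa.B)) x j                ≡⟨ sym (·-assoc fe R Fa.B x j) ⟩
        ∑ (λ l → (fe · R) x l *ᶠ Fa.B l j)
          ≡⟨ ∑-cong {N} (λ l → cong (_*ᶠ Fa.B l j) (trans (cong (λ v → ∑ (λ t → v t *ᶠ R t l)) (fe-in-B x)) (SymplecticInverse.TR Bₑ⁻¹ (pos x) l))) ⟩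
        ∑ (λ l → δ (pos x) l *ᶠ Fa.B l j)   ≡⟨ ∑-δˡ (λ l → Fa.B l j) (pos x) ⟩
        Fa.B (pos x) j                       ≡⟨ cong (λ v → v j) (sym (ff-in-B x)) ⟩
        ff x j                               ∎
        where open ≡-Reasoning

      transports : ∀ {m m′ d s} {P : Mat m N} {Q : Mat m′ N} (bP : TypedBasis P d s) (bQ : TypedBasis Q d s) (pos : Fin d → Fin N) →
        (∀ x → TypedBasis.rows bP x ≡ E.B (pos x)) → (∀ x → TypedBasis.rows bQ x ≡ Fa.B (pos x)) → SameRowSpace (P · T) Q
      transports bP bQ pos bP-in-B bQ-in-B =
        SRS-trans (SRS-· T (SRS-sym (TypedBasis.spans bP)))
          (SRS-trans (SRS-ext (rows-· (TypedBasis.rows bP) (TypedBasis.rows bQ) pos bP-in-B bQ-in-B)) (TypedBasis.spans bQ))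

    adapted-transport : SymplecticTransport e f
    adapted-transport = T , symplectic-· R Fa.B (SymplecticInverse.Rsymp Bₑ⁻¹) Fa.Bsymp ,
      transports E.basis₁ Fa.basis₁ _ E.rows₁-in-B Fa.rows₁-in-B , transports E.basis₂ Fa.basis₂ _ E.rows₂-in-B Fa.rows₂-in-B

  EdgeNumbers-≡ : ∀ (a b : EdgeNumbers) → EdgeNumbers.n-s1 a ≡ EdgeNumbers.n-s1 b → EdgeNumbers.n-s2 a ≡ EdgeNumbers.n-s2 b →
    d1 a ≡ d1 b → d2 a ≡ d2 b → dW a ≡ dW b → a ≡ b
  EdgeNumbers-≡ (nums a1 a2 a3 a4 a5) (nums .a1 .a2 b3 b4 b5) refl refl h1 h2 hW = res
    where
      X-eq : a4 ℕ.+ (a3 ℕ.+ 0) ≡ b4 ℕ.+ (b3 ℕ.+ 0)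
      X-eq = ℕP.+-cancelˡ-≡ (a1 ℕ.+ a1) _ _ h1
      Y-eq : a5 ℕ.+ (a3 ℕ.+ 0) ≡ b5 ℕ.+ (b3 ℕ.+ 0)
      Y-eq = ℕP.+-cancelˡ-≡ (a2 ℕ.+ a2) _ _ h2
      W-eq : a5 ℕ.+ (a4 ℕ.+ (a3 ℕ.+ 0)) ≡ b5 ℕ.+ (b4 ℕ.+ (b3 ℕ.+ 0))
      W-eq = ℕP.+-cancelˡ-≡ ((a1 ℕ.+ a2) ℕ.+ (a1 ℕ.+ a2)) _ _ hW
      e2eq : a5 ≡ b5
      e2eq = ℕP.+-cancelʳ-≡ (b4 ℕ.+ (b3 ℕ.+ 0)) a5 b5 (trans (sym (cong (a5 ℕ.+_) X-eq)) W-eq)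
      I-eq : a3 ℕ.+ 0 ≡ b3 ℕ.+ 0
      I-eq = ℕP.+-cancelˡ-≡ b5 _ _ (trans (cong (ℕ._+ (a3 ℕ.+ 0)) (sym e2eq)) Y-eq)
      eIeq : a3 ≡ b3
      eIeq = trans (sym (ℕP.+-identityʳ a3)) (trans I-eq (ℕP.+-identityʳ b3))
      e1eq : a4 ≡ b4
      e1eq = ℕP.+-cancelʳ-≡ (b3 ℕ.+ 0) a4 b4 (trans (cong (a4 ℕ.+_) (sym I-eq)) X-eq)
      res : nums a1 a2 a3 a4 a5 ≡ nums a1 a2 b3 b4 b5
      res rewrite eIeq | e1eq | e2eq = refl

  transport : (e f : Edge) → ∀ {m} (Q : Mat m N) → SameRowSpace (sumMat (end₁ f) (end₂ f)) Q →
    SameType (mat (end₁ e)) (mat (end₁ f)) → SameType (mat (end₂ e)) (mat (end₂ f)) → SameType (sumMat (end₁ e) (end₂ e)) Q →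
    SymplecticTransport e f
  transport e f Q sumf≈Q t₁ t₂ t₁₂ = adapted-transport e f ne Ae (subst (AdaptedBasis f) (sym ne≡nf) Af)
    where
      ne = proj₁ (adaptedBasis e)
      Ae = proj₂ (adaptedBasis e)
      nf = proj₁ (adaptedBasis f)
      Af = proj₂ (adaptedBasis f)
      module E = AdaptedBasis Ae
      module Fa = AdaptedBasis Af
      n₁ = sameType⇒≡ E.basis₁ Fa.basis₁ t₁
      n₂ = sameType⇒≡ E.basis₂ Fa.basis₂ t₂
      n₁₂ = sameType⇒≡ E.basis₁₂ (typedBasis-resp Fa.basis₁₂ sumf≈Q) t₁₂
      ne≡nf : ne ≡ nf
      ne≡nf = EdgeNumbers-≡ ne nf (proj₂ n₁) (proj₂ n₂) (proj₁ n₁) (proj₁ n₂) (proj₁ n₁₂)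

  swap : Edge → Edge
  swap f = edge (end₂ f) (end₁ f) (λ i j → form-⊥-sym (mat (end₁ f) j) (mat (end₂ f) i) (Edge.orth f j i))

  transport⇒sameOrbit : ∀ {e f} → SymplecticTransport e f → SameOrbit e f
  transport⇒sameOrbit (T , symp , X₁T≈Y₁ , X₂T≈Y₂) = T , symp , inj₁ (X₁T≈Y₁ , X₂T≈Y₂)

  swapped-transport⇒sameOrbit : ∀ {e f} → SymplecticTransport e (swap f) → SameOrbit e f
  swapped-transport⇒sameOrbit (T , symp , X₁T≈Y₂ , X₂T≈Y₁) = T , symp , inj₂ (X₁T≈Y₂ , X₂T≈Y₁)

  typeCondition⇒sameOrbit : (e f : Edge) → TypeCondition e f → SameOrbit e f
  typeCondition⇒sameOrbit e f (inj₁ (t₁ , t₂ , t₁₂)) =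
    transport⇒sameOrbit {e} {f} (transport e f (sumMat (end₁ f) (end₂ f)) (SRS-refl _) t₁ t₂ t₁₂)
  typeCondition⇒sameOrbit e f (inj₂ (t₁ , t₂ , t₁₂)) =
    swapped-transport⇒sameOrbit {e} {f} (transport e (swap f) (sumMat (end₁ f) (end₂ f)) (sumMat-comm (end₁ f) (end₂ f)) t₁ t₂ t₁₂)

lemma3p6 : {q : ℕ} → IsPrimePower q → (F : FiniteField q) → (ν : ℕ) → 1 ≤ ν →
    (e f : Geometry.Edge F ν) →
    Geometry.SameOrbit F ν e f ⇔ Geometry.TypeCondition F ν e f
lemma3p6 _ F ν _ e f = mk⇔ (sameOrbit⇒typeCondition e f) (typeCondition⇒sameOrbit e f)
  where open EdgeOrbits F ν
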